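{- Let $\ell\in\mathbb{N}$. Suppose that $\Gamma\vdash K[L/x]:(u\oplus_\ell w,\tau)$ is derivable in the extended type system, where $L$ is closed, has order $\ell$, and no variable of order at least $\ell$ occurs in $L$ (neither free nor bound). Then $\Gamma\vdash(\lambda x.K)\,L:(u'\oplus_\ell w',\tau)$ is derivable for some $u',w'\in\mathbb{N}$ such that $2^u\cdot w\le 2^{u'}\cdot w'$ and ($u+w=0\Rightarrow u'+w'=0$).
   Context: Sorts are built from the base sort $\mathsf{o}$ by $\to$; $\mathit{ord}(\mathsf{o})=0$, $\mathit{ord}(\alpha\to\beta)=\max(1+\mathit{ord}(\alpha),\mathit{ord}(\beta))$. Lambda-terms are infinitary simply-typed lambda-terms (identified up to alpha-conversion) over the signature with constants $\mathsf{a}:\mathsf{o}\to\mathsf{o}$, $\mathsf{b}:\mathsf{o}\to\mathsf{o}\to\mathsf{o}$, $\mathsf{c}:\mathsf{o}$, $\omega:\mathsf{o}$. The order of a term or variable is the order of its sort. Types: $\mathcal{T}^{\mathsf{o}}=\{\mathsf{r}\}$, $\mathcal{T}^{\alpha\to\beta}=\mathcal{P}(\{\mathsf{pr},\mathsf{np}\}\times\mathcal{T}^\alpha)\times\mathcal{T}^\beta$; an element $(T,\tau)$ is written $\bigwedge_{i\in I}(f_i,\tau_i)\to\tau$ (pairs distinct); $\top$ is the empty conjunction. Type environments $\Gamma$ are finite sets of bindings $x:(g,\sigma)$ ($g\in\{\mathsf{pr},\mathsf{np}\}$, $\sigma$ a type of the sort of $x$; several bindings per variable allowed); $\mathit{dom}(\Gamma)$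 is the set of bound variables; $\Gamma{\restriction}_{\mathsf{pr}}$ the bindings with flag $\mathsf{pr}$; $\Gamma{\restriction}_{\ge\ell}$ and $\Gamma{\restriction}_{<\ell}$ the bindings for variables of order $\ge\ell$ and $<\ell$ respectively; $\mathit{dupl}((\Gamma_i)_{i\in J})=\sum_{i\in J}|\Gamma_i{\restriction}_{\mathsf{pr}}|-|\bigcup_{i\in J}\Gamma_i{\restriction}_{\mathsf{pr}}|$. Extended type system (for fixed $\ell$): judgments $\Gamma\vdash M:(u\oplus_\ell w,\tau)$ with $u,w\in\mathbb{N}$, $\tau$ a type of the sort of $M$, derived by finite derivations from the rules: $\emptyset\vdash\mathsf{a}:(0\oplus_\ell 1,(f,\mathsf{r})\to\mathsf{r})$; $\emptyset\vdash\mathsf{c}:(0\oplus_\ell 0,\mathsf{r})$; $\emptyset\vdash\mathsf{b}:(0\oplus_\ell 0,(f,\mathsf{r})\to\top\to\mathsf{r})$; $\emptyset\vdash\mathsf{b}:(0\oplus_\ell 0,\top\to(f,\mathsf{r})\to\mathsf{r})$ (any $f$); $x:(f,\tau)\vdash x:(0\oplus_\ell 0,\tau)$; ($\lambda$): from $\Gamma\cup\{x:(f_i,\tau_i)\mid i\in I\}\vdash K:(u\oplus_\ell w,\tau)$ with $x\notin\mathit{dom}(\Gamma)$ infer $\Gamma\vdash\lambda x.K:(u\oplus_\ell w,\bigwedge_{i\in I}(f_i,\tau_i)\to\tau)$; ($@$): if $0\notin I$, $\Gamma_0\vdash K:(u_0\oplus_\ell w_0,\bigwedge_{i\in I}(f_i,\tau_i)\to\tau)$,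 and for each $i\in I$, $\Gamma_i\vdash L:(u_i\oplus_\ell w_i,\tau_i)$ with $f_i=\mathsf{pr}$ iff ($u_i+w_i>0$ or $\Gamma_i{\restriction}_{\mathsf{pr}}\neq\emptyset$), infer $\bigcup_{i\in\{0\}\cup I}\Gamma_i\vdash K\,L:(u\oplus_\ell w,\tau)$ where $u=\mathit{dupl}((\Gamma_i{\restriction}_{\ge\ell})_{i\in\{0\}\cup I})+\sum_{i\in\{0\}\cup I}u_i$ and $w=\mathit{dupl}((\Gamma_i{\restriction}_{<\ell})_{i\in\{0\}\cup I})+\sum_{i\in\{0\}\cup I}w_i$. There is no rule for $\omega$. -}

module Defs where

open import Data.Nat using (ℕ; zero; suc; _+_; _∸_; _⊔_; _<ᵇ_; _≤ᵇ_)
open import Data.Bool using (Bool; true; false; if_then_else_)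
open import Data.Fin using (Fin; zero; suc)
open import Data.Fin.Subset using (Subset; inside; outside; _∪_; ∣_∣; ⁅_⁆) renaming (⊥ to ∅ₛ)
open import Data.List using (List; []; _∷_; _++_; length; lookup; map; cartesianProduct; cartesianProductWith)
open import Data.List.Relation.Unary.All using (All; []; _∷_)
open import Data.Vec using (Vec; []; _∷_)
open import Data.Product using (_×_; _,_; proj₁; proj₂)
open import Data.Sum using (_⊎_; inj₁; inj₂)
open import Data.Nat using (_<_)
open import Data.Fin.Subset using (_∈_)
open import Data.Unit using (⊤; tt)
open import Relation.Binary.PropositionalEquality using (_≡_; _≢_; refl)
open import Function.Bundles using (_⇔_)

infixr 5 _⇒_
data Sort : Set where
  o   : Sort
  _⇒_ : Sort → Sort → Sort

ord : Sort → ℕ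
ord o       = 0
ord (α ⇒ β) = suc (ord α) ⊔ ord β

Ctx : Set
Ctx = List Sort

data _∋_ : Ctx → Sort → Set where
  here  : ∀ {Δ α} → (α ∷ Δ) ∋ α
  there : ∀ {Δ α β} → Δ ∋ α → (β ∷ Δ) ∋ α

-- Infinitary simply-typed lambda-terms, represented coalgebraically:
-- a term system assigns to each state (in a context, of a sort) its
-- head node; a state thereby denotes a possibly infinite term (its
-- unfolding).  Every infinitary term is the unfolding of a state of
-- some system (e.g. the system of its own subterms).

data Node (X : Ctx → Sort → Set) (Δ : Ctx) : Sort → Set where
  var : ∀ {α} → Δ ∋ α → Node X Δ α
  cA  : Node X Δ (o ⇒ o)
  cB  : Node X Δ (o ⇒ o ⇒ o)
  cC  : Node X Δ o
  cω  : Node X Δ o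
  lam : ∀ {α β} → X (α ∷ Δ) β → Node X Δ (α ⇒ β)
  app : ∀ {α β} → X Δ (α ⇒ β) → X Δ α → Node X Δ β

record TermSystem : Set₁ where
  field
    St   : Ctx → Sort → Set
    step : ∀ {Δ α} → St Δ α → Node St Δ α
open TermSystem public

-- Ty α is finite; allTy α enumerates it (without repetition), and a
-- set of pairs (flag , type) is given by two subsets of the indices
-- of allTy α: the pr-part and the np-part.

data Flag : Set where
  pr np : Flag

data TyO : Set where
  r : TyO

allSubsets : (n : ℕ) → List (Subset n)
allSubsets zero    = [] ∷ []
allSubsets (suc n) = map (inside ∷_) (allSubsets n) ++ map (outside ∷_) (allSubsets n)

mutual
  Ty : Sort → Set
  Ty o       = TyO
  Ty (α ⇒ β) = Conj α × Ty β

  record Conj (α : Sort) : Set where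
    inductive
    constructor ⟨_,_⟩
    field
      prs : Subset (size α)
      nps : Subset (size α)

  size : Sort → ℕ
  size α = length (allTy α)

  allTy : (α : Sort) → List (Ty α)
  allTy o       = r ∷ []
  allTy (α ⇒ β) = cartesianProduct (cartesianProductWith ⟨_,_⟩ (allSubsets (size α)) (allSubsets (size α))) (allTy β)

decode : ∀ {α} → Fin (size α) → Ty α
decode {α} i = lookup (allTy α) i

sel : ∀ {α} → Flag → Conj α → Subset (size α)
sel pr ⟨ p , q ⟩ = p
sel np ⟨ p , q ⟩ = q

⊤C : ∀ {α} → Conj α
⊤C = ⟨ ∅ₛ , ∅ₛ ⟩

only : ∀ {α} → Flag → Fin (size α) → Conj α
only pr i = ⟨ ⁅ i ⁆ , ∅ₛ ⟩
only np i = ⟨ ∅ₛ , ⁅ i ⁆ ⟩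

_∪C_ : ∀ {α} → Conj α → Conj α → Conj α
⟨ p , q ⟩ ∪C ⟨ p' , q' ⟩ = ⟨ p ∪ p' , q ∪ q' ⟩

rTy : Fin (size o)
rTy = zero

Env : Ctx → Set
Env Δ = All Conj Δ

∅E : ∀ {Δ} → Env Δ
∅E {[]}    = []
∅E {α ∷ Δ} = ⊤C ∷ ∅E

_∪E_ : ∀ {Δ} → Env Δ → Env Δ → Env Δ
[]       ∪E []       = []
(C ∷ Γ) ∪E (D ∷ Γ') = (C ∪C D) ∷ (Γ ∪E Γ')

single : ∀ {Δ α} → Δ ∋ α → Flag → Fin (size α) → Env Δ
single here      f i = only f i ∷ ∅E
single (there x) f i = ⊤C ∷ single x f i

_↾pr : ∀ {Δ} → Env Δ → Env Δ
[]            ↾pr = []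
(⟨ p , q ⟩ ∷ Γ) ↾pr = ⟨ p , ∅ₛ ⟩ ∷ (Γ ↾pr)

restrictBy : (ℕ → Bool) → ∀ {Δ} → Env Δ → Env Δ
restrictBy P {[]}    []      = []
restrictBy P {α ∷ Δ} (C ∷ Γ) = (if P (ord α) then C else ⊤C) ∷ restrictBy P Γ

_↾≥_ : ∀ {Δ} → Env Δ → ℕ → Env Δ
Γ ↾≥ ℓ = restrictBy (λ k → ℓ ≤ᵇ k) Γ

_↾<_ : ∀ {Δ} → Env Δ → ℕ → Env Δ
Γ ↾< ℓ = restrictBy (λ k → k <ᵇ ℓ) Γ

∣_∣E : ∀ {Δ} → Env Δ → ℕ
∣ [] ∣E          = 0
∣ ⟨ p , q ⟩ ∷ Γ ∣E = ∣ p ∣ + ∣ q ∣ + ∣ Γ ∣E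

sumSub : ∀ {n} → Subset n → (Fin n → ℕ) → ℕ
sumSub []            g = 0
sumSub (inside ∷ p)  g = g zero + sumSub p (λ i → g (suc i))
sumSub (outside ∷ p) g = sumSub p (λ i → g (suc i))

unionSub : ∀ {n Δ} → Subset n → (Fin n → Env Δ) → Env Δ
unionSub []            g = ∅E
unionSub (inside ∷ p)  g = g zero ∪E unionSub p (λ i → g (suc i))
unionSub (outside ∷ p) g = unionSub p (λ i → g (suc i))

sumC : ∀ {α} → Conj α → (Flag → Fin (size α) → ℕ) → ℕ
sumC C g = sumSub (sel pr C) (g pr) + sumSub (sel np C) (g np)

unionC : ∀ {α Δ} → Conj α → (Flag → Fin (size α) → Env Δ) → Env Δ
unionC C g = unionSub (sel pr C) (g pr) ∪E unionSub (sel np C) (g np)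

-- dupl((R Γ_j)_{j ∈ {0} ∪ I}) where the family is Γ₀ together with
-- (Γs f i) for the elements (f , i) of C, and R is a restriction
duplC : ∀ {α Δ} → (Env Δ → Env Δ) → Env Δ → Conj α → (Flag → Fin (size α) → Env Δ) → ℕ
duplC R Γ₀ C Γs =
  (∣ R Γ₀ ↾pr ∣E + sumC C (λ f i → ∣ R (Γs f i) ↾pr ∣E))
  ∸ ∣ (R Γ₀ ∪E unionC C (λ f i → R (Γs f i))) ↾pr ∣E

-- Der ℓ S Γ s u w τ  is the judgment  Γ ⊢ s : (u ⊕_ℓ w , τ).
-- In the application rule the premises for L are indexed by the
-- elements (f , decode i) of the conjunction C (i ∈ sel f C); Γs, us,
-- ws give their environments and counters (values at non-members are
-- irrelevant: they are never used).

data DerN (ℓ : ℕ) (S : TermSystem) : {Δ : Ctx} {α : Sort} → Env Δ → Node (St S) Δ α → ℕ → ℕ → Ty α → Set where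
  ruleA : ∀ {Δ} (f : Flag) → DerN ℓ S {Δ} ∅E cA 0 1 (only f rTy , r)
  ruleC : ∀ {Δ} → DerN ℓ S {Δ} ∅E cC 0 0 r
  ruleB₁ : ∀ {Δ} (f : Flag) → DerN ℓ S {Δ} ∅E cB 0 0 (only f rTy , (⊤C , r))
  ruleB₂ : ∀ {Δ} (f : Flag) → DerN ℓ S {Δ} ∅E cB 0 0 (⊤C , (only f rTy , r))
  ruleVar : ∀ {Δ α} (x : Δ ∋ α) (f : Flag) (i : Fin (size α)) → DerN ℓ S (single x f i) (var x) 0 0 (decode i)
  ruleLam : ∀ {Δ α β} {s : St S (α ∷ Δ) β} {Γ : Env Δ} {C : Conj α} {u w : ℕ} {τ : Ty β}
    → DerN ℓ S (C ∷ Γ) (step S s) u w τ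
    → DerN ℓ S Γ (lam s) u w (C , τ)
  ruleApp : ∀ {Δ α β} {s₁ : St S Δ (α ⇒ β)} {s₂ : St S Δ α} {Γ₀ : Env Δ} {u₀ w₀ : ℕ} {C : Conj α} {τ : Ty β}
    (Γs : Flag → Fin (size α) → Env Δ) (us ws : Flag → Fin (size α) → ℕ)
    → DerN ℓ S Γ₀ (step S s₁) u₀ w₀ (C , τ)
    → (∀ f i → i ∈ sel f C → DerN ℓ S (Γs f i) (step S s₂) (us f i) (ws f i) (decode i))
    → (∀ f i → i ∈ sel f C → ((f ≡ pr) ⇔ ((0 < us f i + ws f i) ⊎ ((Γs f i) ↾pr ≢ ∅E))))
    → DerN ℓ S (Γ₀ ∪E unionC C Γs) (app s₁ s₂)
        (duplC (λ Γ → Γ ↾≥ ℓ) Γ₀ C Γs + (u₀ + sumC C us))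
        (duplC (λ Γ → Γ ↾< ℓ) Γ₀ C Γs + (w₀ + sumC C ws))
        τ

Der : (ℓ : ℕ) (S : TermSystem) {Δ : Ctx} {α : Sort} → Env Δ → St S Δ α → ℕ → ℕ → Ty α → Set
Der ℓ S Γ s u w τ = DerN ℓ S Γ (step S s) u w τ

data Reach (S : TermSystem) : ∀ {Θ α Θ' α'} → St S Θ α → St S Θ' α' → Set where
  done   : ∀ {Θ α} {s : St S Θ α} → Reach S s s
  viaLam : ∀ {Θ α β Θ' α'} {s : St S Θ (α ⇒ β)} {s' : St S (α ∷ Θ) β} {t : St S Θ' α'}
    → step S s ≡ lam s' → Reach S s' t → Reach S s t
  viaFun : ∀ {Θ α β Θ' α'} {s : St S Θ β} {s₁ : St S Θ (α ⇒ β)} {s₂ : St S Θ α} {t : St S Θ' α'}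
    → step S s ≡ app s₁ s₂ → Reach S s₁ t → Reach S s t
  viaArg : ∀ {Θ α β Θ' α'} {s : St S Θ β} {s₁ : St S Θ (α ⇒ β)} {s₂ : St S Θ α} {t : St S Θ' α'}
    → step S s ≡ app s₁ s₂ → Reach S s₂ t → Reach S s t

LowNode : ∀ {X Θ α} → ℕ → Node X Θ α → Set
LowNode ℓ (var {α} x) = ord α < ℓ
LowNode ℓ (lam {α} s) = ord α < ℓ
LowNode ℓ _           = ⊤

NoHighVars : (ℓ : ℕ) (S : TermSystem) {Θ : Ctx} {α : Sort} → St S Θ α → Set
NoHighVars ℓ S s = ∀ {Θ' α'} (t : St S Θ' α') → Reach S s t → LowNode ℓ (step S t)

-- Substitution of a closed term L for the variable x (de Bruijn 0) in
-- K, and the redex (λx.K) L, realised in an extension of the system S.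
-- States of XSt S L:
--   orig s      : s itself
--   wk Ξ Θ s    : s (in context Ξ) weakened by Θ
--   sub Ξ Δ s   : s[L/x] where x is the variable at depth |Ξ|
--   redex K     : (λx.K) L
--   lamOf K     : λx.K

module _ (S : TermSystem) {σ : Sort} (L : St S [] σ) where

  data XSt : Ctx → Sort → Set where
    orig  : ∀ {Θ α} → St S Θ α → XSt Θ α
    wk    : ∀ Ξ Θ {α} → St S Ξ α → XSt (Ξ ++ Θ) α
    sub   : ∀ Ξ Δ {α} → St S (Ξ ++ σ ∷ Δ) α → XSt (Ξ ++ Δ) α
    redex : ∀ {Δ β} → St S (σ ∷ Δ) β → XSt Δ β
    lamOf : ∀ {Δ β} → St S (σ ∷ Δ) β → XSt Δ (σ ⇒ β)

  wkVar : ∀ Ξ Θ {α} → Ξ ∋ α → (Ξ ++ Θ) ∋ α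
  wkVar (β ∷ Ξ) Θ here      = here
  wkVar (β ∷ Ξ) Θ (there x) = there (wkVar Ξ Θ x)

  splitVar : ∀ Ξ {Δ α} → (Ξ ++ σ ∷ Δ) ∋ α → (α ≡ σ) ⊎ ((Ξ ++ Δ) ∋ α)
  splitVar []      here      = inj₁ refl
  splitVar []      (there x) = inj₂ x
  splitVar (β ∷ Ξ) here      = inj₂ here
  splitVar (β ∷ Ξ) (there x) with splitVar Ξ x
  ... | inj₁ e = inj₁ e
  ... | inj₂ y = inj₂ (there y)

  nodeOrig : ∀ {Θ α} → Node (St S) Θ α → Node XSt Θ α
  nodeOrig (var x)     = var x
  nodeOrig cA          = cA
  nodeOrig cB          = cB
  nodeOrig cC          = cC
  nodeOrig cω          = cω
  nodeOrig (lam s)     = lam (orig s)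
  nodeOrig (app s₁ s₂) = app (orig s₁) (orig s₂)

  nodeWk : ∀ Ξ Θ {α} → Node (St S) Ξ α → Node XSt (Ξ ++ Θ) α
  nodeWk Ξ Θ (var x)       = var (wkVar Ξ Θ x)
  nodeWk Ξ Θ cA            = cA
  nodeWk Ξ Θ cB            = cB
  nodeWk Ξ Θ cC            = cC
  nodeWk Ξ Θ cω            = cω
  nodeWk Ξ Θ (lam {α} s)   = lam (wk (α ∷ Ξ) Θ s)
  nodeWk Ξ Θ (app s₁ s₂)   = app (wk Ξ Θ s₁) (wk Ξ Θ s₂)

  nodeSub : ∀ Ξ Δ {α} → Node (St S) (Ξ ++ σ ∷ Δ) α → Node XSt (Ξ ++ Δ) α
  nodeSub Ξ Δ (var x) with splitVar Ξ x
  ... | inj₁ refl = nodeWk [] (Ξ ++ Δ) (step S L)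
  ... | inj₂ y    = var y
  nodeSub Ξ Δ cA            = cA
  nodeSub Ξ Δ cB            = cB
  nodeSub Ξ Δ cC            = cC
  nodeSub Ξ Δ cω            = cω
  nodeSub Ξ Δ (lam {α} s)   = lam (sub (α ∷ Ξ) Δ s)
  nodeSub Ξ Δ (app s₁ s₂)   = app (sub Ξ Δ s₁) (sub Ξ Δ s₂)

  xstep : ∀ {Θ α} → XSt Θ α → Node XSt Θ α
  xstep (orig s)          = nodeOrig (step S s)
  xstep (wk Ξ Θ s)        = nodeWk Ξ Θ (step S s)
  xstep (sub Ξ Δ s)       = nodeSub Ξ Δ (step S s)
  xstep (redex {Δ} K)     = app (lamOf K) (wk [] Δ L)
  xstep (lamOf K)         = lam (orig K)

  XSys : TermSystem
  XSys = record { St = XSt ; step = xstep }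

  substTm : ∀ {Δ β} → St S (σ ∷ Δ) β → XSt Δ β
  substTm {Δ} K = sub [] Δ K

  redexTm : ∀ {Δ β} → St S (σ ∷ Δ) β → XSt Δ β
  redexTm K = redex K

{-# OPTIONS --safe #-}
module Submission where

-- Every copy of L in K[L/x] is typed by a subderivation, which has the empty environment and
-- u = 0 because L is closed and all its variables have order < ℓ. Collecting the types of
-- these subderivations into a binding for x (flag pr when w > 0, keeping for each type only
-- a copy of largest w) turns the derivation of K[L/x] into one of K, and λ together with one
-- derivation of L per collected type gives one of (λx.K) L. As ord x = ℓ, the merging of
-- bindings of x raises u by some d, while the w of the discarded copies is lost; but each
-- merge of two bindings of the same pr-type at most doubles the weight that is kept, so the
-- total w of all copies is at most 2^d times the kept one, whence 2^u w ≤ 2^(u+d) w'.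

open import Defs
open import Data.Bool using (Bool; true; false; if_then_else_)
open import Data.Bool.Properties using (T-≡)
open import Data.Empty using (⊥-elim)
open import Data.Fin using (Fin; zero; suc) renaming (_≟_ to _≟ᶠ_)
open import Data.Fin.Subset using (Subset; inside; outside; _∪_; _∩_; ∣_∣; ⁅_⁆; _∈_; _∉_) renaming (⊥ to ∅ₛ)
open import Data.Fin.Subset.Properties
  using (∉⊥; ∣⊥∣≡0; _∈?_; ∪-identityˡ; ∪-identityʳ; x∈p∪q⁻; x∈p∪q⁺; x∈⁅x⁆; x∈⁅y⁆⇒x≡y; ∣⁅x⁆∣≡1)
open import Data.List using ([]; _∷_; _++_; map)
import Data.List.Membership.Propositional as List
open import Data.List.Membership.Propositional.Properties
  using (∈-map⁺; ∈-++⁺ˡ; ∈-++⁺ʳ; ∈-cartesianProduct⁺; ∈-cartesianProductWith⁺)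
open import Data.List.Relation.Unary.All using (All; []; _∷_)
import Data.List.Relation.Unary.All as All
import Data.List.Relation.Unary.Any as Any
open import Data.List.Relation.Unary.Any.Properties using (lookup-index)
open import Data.Nat using (ℕ; zero; suc; _+_; _*_; _^_; _≤_; _<_; _∸_; _⊔_; _≤ᵇ_; _<ᵇ_; z≤n; s≤s; z<s)
open import Data.Nat.Properties
open import Data.Nat.Solver using (module +-*-Solver)
open import Data.Product using (Σ; _×_; _,_; proj₁; proj₂)
open import Data.Sum using (_⊎_; inj₁; inj₂; [_,_]; map₂)
open import Data.Unit using (⊤; tt)
open import Data.Vec using ([]; _∷_; here; there)
open import Data.Vec.Properties.WithK using ([]=-irrelevant)
open import Function using (_∘_)
open import Function.Bundles using (_⇔_; mk⇔; Equivalence)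
open import Function.Construct.Composition using (_⇔-∘_)
open import Function.Construct.Symmetry using (⇔-sym)
open import Relation.Nullary using (yes; no; contradiction)
open import Relation.Binary.PropositionalEquality hiding ([_])
open import Algebra.Properties.CommutativeSemigroup +-commutativeSemigroup using (interchange; x∙yz≈y∙xz)
open +-*-Solver using (solve; _:+_; _:=_)

<ᵇ-false : ∀ {m n} → n ≤ m → (m <ᵇ n) ≡ false
<ᵇ-false {zero}  z≤n       = refl
<ᵇ-false {suc m} z≤n       = refl
<ᵇ-false         (s≤s n≤m) = <ᵇ-false n≤m

≤ᵇ-false : ∀ {m n} → n < m → (m ≤ᵇ n) ≡ false
≤ᵇ-false (s≤s n≤m) = <ᵇ-false n≤m

[m+n]∸[o+p]≡[m∸o]+[n∸p] : ∀ {m n o p} → o ≤ m → p ≤ n → (m + n) ∸ (o + p) ≡ (m ∸ o) + (n ∸ p)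
[m+n]∸[o+p]≡[m∸o]+[n∸p] {m} z≤n       p≤n = +-∸-assoc m p≤n
[m+n]∸[o+p]≡[m∸o]+[n∸p]     (s≤s o≤m) p≤n = [m+n]∸[o+p]≡[m∸o]+[n∸p] o≤m p≤n

+-mono-≤-2^ : ∀ {x y X Y} a b → x ≤ 2 ^ a * X → y ≤ 2 ^ b * Y → x + y ≤ 2 ^ (a + b) * (X + Y)
+-mono-≤-2^ {x} {y} {X} {Y} a b x≤ y≤ = begin
  x + y                              ≤⟨ +-mono-≤ x≤ y≤ ⟩
  2 ^ a * X + 2 ^ b * Y              ≤⟨ +-mono-≤ (*-monoˡ-≤ X (^-monoʳ-≤ 2 (m≤m+n a b))) (*-monoˡ-≤ Y (^-monoʳ-≤ 2 (m≤n+m b a))) ⟩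
  2 ^ (a + b) * X + 2 ^ (a + b) * Y  ≡⟨ *-distribˡ-+ (2 ^ (a + b)) X Y ⟨
  2 ^ (a + b) * (X + Y)              ∎
  where open ≤-Reasoning

≤-2^-trans : ∀ {x y z} a b → x ≤ 2 ^ a * y → y ≤ 2 ^ b * z → x ≤ 2 ^ (a + b) * z
≤-2^-trans {x} {y} {z} a b x≤ y≤ = begin
  x                     ≤⟨ x≤ ⟩
  2 ^ a * y             ≤⟨ *-monoʳ-≤ (2 ^ a) y≤ ⟩
  2 ^ a * (2 ^ b * z)   ≡⟨ *-assoc (2 ^ a) (2 ^ b) z ⟨
  2 ^ a * 2 ^ b * z     ≡⟨ cong (_* z) (^-distribˡ-+-* 2 a b) ⟨
  2 ^ (a + b) * z       ∎
  where open ≤-Reasoning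

∣p∣+∣q∣≡∣p∪q∣+∣p∩q∣ : ∀ {n} (p q : Subset n) → ∣ p ∣ + ∣ q ∣ ≡ ∣ p ∪ q ∣ + ∣ p ∩ q ∣
∣p∣+∣q∣≡∣p∪q∣+∣p∩q∣ []            []            = refl
∣p∣+∣q∣≡∣p∪q∣+∣p∩q∣ (inside ∷ p)  (inside ∷ q)  = cong suc (begin
  ∣ p ∣ + suc ∣ q ∣         ≡⟨ +-suc ∣ p ∣ ∣ q ∣ ⟩
  suc (∣ p ∣ + ∣ q ∣)       ≡⟨ cong suc (∣p∣+∣q∣≡∣p∪q∣+∣p∩q∣ p q) ⟩
  suc (∣ p ∪ q ∣ + ∣ p ∩ q ∣) ≡⟨ +-suc ∣ p ∪ q ∣ ∣ p ∩ q ∣ ⟨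
  ∣ p ∪ q ∣ + suc ∣ p ∩ q ∣ ∎)
  where open ≡-Reasoning
∣p∣+∣q∣≡∣p∪q∣+∣p∩q∣ (inside ∷ p)  (outside ∷ q) = cong suc (∣p∣+∣q∣≡∣p∪q∣+∣p∩q∣ p q)
∣p∣+∣q∣≡∣p∪q∣+∣p∩q∣ (outside ∷ p) (inside ∷ q)  = trans (+-suc ∣ p ∣ ∣ q ∣) (cong suc (∣p∣+∣q∣≡∣p∪q∣+∣p∩q∣ p q))
∣p∣+∣q∣≡∣p∪q∣+∣p∩q∣ (outside ∷ p) (outside ∷ q) = ∣p∣+∣q∣≡∣p∪q∣+∣p∩q∣ p q

∣p∪q∣≤∣p∣+∣q∣ : ∀ {n} (p q : Subset n) → ∣ p ∪ q ∣ ≤ ∣ p ∣ + ∣ q ∣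
∣p∪q∣≤∣p∣+∣q∣ p q = ≤-trans (m≤m+n ∣ p ∪ q ∣ ∣ p ∩ q ∣) (≤-reflexive (sym (∣p∣+∣q∣≡∣p∪q∣+∣p∩q∣ p q)))

∣p∣≡0⇒p≡∅ : ∀ {n} (p : Subset n) → ∣ p ∣ ≡ 0 → p ≡ ∅ₛ
∣p∣≡0⇒p≡∅ []            _  = refl
∣p∣≡0⇒p≡∅ (outside ∷ p) eq = cong (outside ∷_) (∣p∣≡0⇒p≡∅ p eq)

∈∪-⊔-elim : ∀ {n} (p q : Subset n) {g h : Fin n → ℕ} (P : Fin n → ℕ → Set) →
  (∀ i → i ∉ p → g i ≡ 0) → (∀ i → i ∉ q → h i ≡ 0) →
  (∀ i → i ∈ p → P i (g i)) → (∀ i → i ∈ q → P i (h i)) → ∀ i → i ∈ p ∪ q → P i (g i ⊔ h i)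
∈∪-⊔-elim p q {g} {h} P g-out h-out Pg Ph i i∈p∪q with i ∈? p | i ∈? q
... | yes i∈p | no  i∉q = subst (P i) (sym (trans (cong (g i ⊔_) (h-out i i∉q)) (⊔-identityʳ (g i)))) (Pg i i∈p)
... | no  i∉p | yes i∈q = subst (P i) (sym (cong (_⊔ h i) (g-out i i∉p))) (Ph i i∈q)
... | no  i∉p | no  i∉q = ⊥-elim ([ i∉p , i∉q ] (x∈p∪q⁻ p q i∈p∪q))
... | yes i∈p | yes i∈q with ⊔-sel (g i) (h i)
...   | inj₁ ⊔≡g = subst (P i) (sym ⊔≡g) (Pg i i∈p)
...   | inj₂ ⊔≡h = subst (P i) (sym ⊔≡h) (Ph i i∈q)

indicator : ∀ {n} → Fin n → ℕ → Fin n → ℕ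
indicator i w j with j ≟ᶠ i
... | yes _ = w
... | no  _ = 0

indicator-at : ∀ {n} (i : Fin n) w → indicator i w i ≡ w
indicator-at i w with i ≟ᶠ i
... | yes _   = refl
... | no  i≢i = contradiction refl i≢i

indicator-out : ∀ {n} (i : Fin n) w j → j ≢ i → indicator i w j ≡ 0
indicator-out i w j j≢i with j ≟ᶠ i
... | yes j≡i = contradiction j≡i j≢i
... | no  _   = refl

sumSub-cong : ∀ {n} (p : Subset n) {g h : Fin n → ℕ} → (∀ i → i ∈ p → g i ≡ h i) → sumSub p g ≡ sumSub p h
sumSub-cong []            eq = refl
sumSub-cong (inside ∷ p)  eq = cong₂ _+_ (eq zero here) (sumSub-cong p (λ i i∈p → eq (suc i) (there i∈p)))
sumSub-cong (outside ∷ p) eq = sumSub-cong p (λ i i∈p → eq (suc i) (there i∈p))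

sumSub-mono-≤ : ∀ {n} (p : Subset n) {g h : Fin n → ℕ} → (∀ i → i ∈ p → g i ≤ h i) → sumSub p g ≤ sumSub p h
sumSub-mono-≤ []            le = z≤n
sumSub-mono-≤ (inside ∷ p)  le = +-mono-≤ (le zero here) (sumSub-mono-≤ p (λ i i∈p → le (suc i) (there i∈p)))
sumSub-mono-≤ (outside ∷ p) le = sumSub-mono-≤ p (λ i i∈p → le (suc i) (there i∈p))

sumSub-zero : ∀ {n} (p : Subset n) {g : Fin n → ℕ} → (∀ i → i ∈ p → g i ≡ 0) → sumSub p g ≡ 0
sumSub-zero []            eq = refl
sumSub-zero (inside ∷ p)  eq = cong₂ _+_ (eq zero here) (sumSub-zero p (λ i i∈p → eq (suc i) (there i∈p)))
sumSub-zero (outside ∷ p) eq = sumSub-zero p (λ i i∈p → eq (suc i) (there i∈p))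

sumSub-distrib-+ : ∀ {n} (p : Subset n) (g h : Fin n → ℕ) → sumSub p (λ i → g i + h i) ≡ sumSub p g + sumSub p h
sumSub-distrib-+ []            g h = refl
sumSub-distrib-+ (inside ∷ p)  g h =
  trans (cong (g zero + h zero +_) (sumSub-distrib-+ p _ _)) (interchange (g zero) (h zero) _ _)
sumSub-distrib-+ (outside ∷ p) g h = sumSub-distrib-+ p _ _

sumSub-∅ : ∀ n (g : Fin n → ℕ) → sumSub (∅ₛ {n}) g ≡ 0
sumSub-∅ zero    g = refl
sumSub-∅ (suc n) g = sumSub-∅ n _

sumSub-⁅⁆ : ∀ {n} (i : Fin n) (g : Fin n → ℕ) → sumSub ⁅ i ⁆ g ≡ g i
sumSub-⁅⁆ {suc n} zero    g = trans (cong (g zero +_) (sumSub-∅ n _)) (+-identityʳ _)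
sumSub-⁅⁆         (suc i) g = sumSub-⁅⁆ i _

sumSub-2^*≤ : ∀ {n} (p : Subset n) (d x : Fin n → ℕ) → sumSub p (λ i → 2 ^ d i * x i) ≤ 2 ^ sumSub p d * sumSub p x
sumSub-2^*≤ []            d x = z≤n
sumSub-2^*≤ (inside ∷ p)  d x = +-mono-≤-2^ (d zero) _ ≤-refl (sumSub-2^*≤ p _ _)
sumSub-2^*≤ (outside ∷ p) d x = sumSub-2^*≤ p _ _

sumSub-∪-⊔ : ∀ {n} (p q : Subset n) (g h : Fin n → ℕ) →
  sumSub p g + sumSub q h ≤ 2 ^ ∣ p ∩ q ∣ * sumSub (p ∪ q) (λ i → g i ⊔ h i)
sumSub-∪-⊔ []      []      g h = z≤n
sumSub-∪-⊔ (x ∷ p) (y ∷ q) g h = head x y (sumSub-∪-⊔ p q (g ∘ suc) (h ∘ suc))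
  where
  Sp = sumSub p (g ∘ suc)
  Sq = sumSub q (h ∘ suc)
  M = g zero ⊔ h zero
  g≤M = ≤-trans (m≤m⊔n (g zero) (h zero)) (m≤m+n M 0)
  h≤M = ≤-trans (m≤n⊔m (g zero) (h zero)) (m≤m+n M 0)
  head : ∀ x y → Sp + Sq ≤ 2 ^ ∣ p ∩ q ∣ * sumSub (p ∪ q) (λ i → g (suc i) ⊔ h (suc i)) →
    sumSub (x ∷ p) g + sumSub (y ∷ q) h ≤ 2 ^ ∣ (x ∷ p) ∩ (y ∷ q) ∣ * sumSub ((x ∷ p) ∪ (y ∷ q)) (λ i → g i ⊔ h i)
  head inside  inside  ih = ≤-trans (≤-reflexive (interchange (g zero) Sp (h zero) Sq))
                                    (+-mono-≤-2^ 1 ∣ p ∩ q ∣ (+-mono-≤ (m≤m⊔n (g zero) (h zero)) h≤M) ih)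
  head inside  outside ih = ≤-trans (≤-reflexive (+-assoc (g zero) Sp Sq)) (+-mono-≤-2^ 0 ∣ p ∩ q ∣ g≤M ih)
  head outside inside  ih = ≤-trans (≤-reflexive (x∙yz≈y∙xz Sp (h zero) Sq)) (+-mono-≤-2^ 0 ∣ p ∩ q ∣ h≤M ih)
  head outside outside ih = ih

sumC-cong : ∀ {α} (C : Conj α) {g h : Flag → Fin (size α) → ℕ} →
  (∀ f i → i ∈ sel f C → g f i ≡ h f i) → sumC C g ≡ sumC C h
sumC-cong C eq = cong₂ _+_ (sumSub-cong (sel pr C) (eq pr)) (sumSub-cong (sel np C) (eq np))

sumC-mono-≤ : ∀ {α} (C : Conj α) {g h : Flag → Fin (size α) → ℕ} →
  (∀ f i → i ∈ sel f C → g f i ≤ h f i) → sumC C g ≤ sumC C h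
sumC-mono-≤ C le = +-mono-≤ (sumSub-mono-≤ (sel pr C) (le pr)) (sumSub-mono-≤ (sel np C) (le np))

sumC-zero : ∀ {α} (C : Conj α) {g : Flag → Fin (size α) → ℕ} → (∀ f i → i ∈ sel f C → g f i ≡ 0) → sumC C g ≡ 0
sumC-zero C eq = cong₂ _+_ (sumSub-zero (sel pr C) (eq pr)) (sumSub-zero (sel np C) (eq np))

sumC-distrib-+ : ∀ {α} (C : Conj α) (g h : Flag → Fin (size α) → ℕ) →
  sumC C (λ f i → g f i + h f i) ≡ sumC C g + sumC C h
sumC-distrib-+ C g h =
  trans (cong₂ _+_ (sumSub-distrib-+ (sel pr C) (g pr) (h pr)) (sumSub-distrib-+ (sel np C) (g np) (h np)))
        (interchange (sumSub (sel pr C) (g pr)) _ _ _)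

sumC-2^*≤ : ∀ {α} (C : Conj α) (d x : Flag → Fin (size α) → ℕ) →
  sumC C (λ f i → 2 ^ d f i * x f i) ≤ 2 ^ sumC C d * sumC C x
sumC-2^*≤ C d x = +-mono-≤-2^ (sumSub (sel pr C) (d pr)) _ (sumSub-2^*≤ (sel pr C) (d pr) (x pr)) (sumSub-2^*≤ (sel np C) (d np) (x np))

-- ruleApp takes total families, whose values off the members of C do not matter.
extendC : ∀ {α} {A : Set} (C : Conj α) → (∀ f i → i ∈ sel f C → A) → A → Flag → Fin (size α) → A
extendC C F a f i with i ∈? sel f C
... | yes i∈C = F f i i∈C
... | no  _   = a

extendC-∈ : ∀ {α} {A : Set} (C : Conj α) (F : ∀ f i → i ∈ sel f C → A) a f i (i∈C : i ∈ sel f C) →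
  extendC C F a f i ≡ F f i i∈C
extendC-∈ C F a f i i∈C with i ∈? sel f C
... | yes i∈C′ = cong (F f i) ([]=-irrelevant i∈C′ i∈C)
... | no  i∉C  = ⊥-elim (i∉C i∈C)

∪C-identityˡ : ∀ {α} (C : Conj α) → ⊤C ∪C C ≡ C
∪C-identityˡ ⟨ p , q ⟩ = cong₂ ⟨_,_⟩ (∪-identityˡ p) (∪-identityˡ q)

∪C-identityʳ : ∀ {α} (C : Conj α) → C ∪C ⊤C ≡ C
∪C-identityʳ ⟨ p , q ⟩ = cong₂ ⟨_,_⟩ (∪-identityʳ p) (∪-identityʳ q)

∣_∣prC : ∀ {α} → Conj α → ℕ
∣ X ∣prC = ∣ Conj.prs X ∣

∣⊤C∣prC : ∀ {α} → ∣ ⊤C {α} ∣prC ≡ 0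
∣⊤C∣prC {α} = ∣⊥∣≡0 (size α)

∣∪C∣prC≤ : ∀ {α} (X Y : Conj α) → ∣ X ∪C Y ∣prC ≤ ∣ X ∣prC + ∣ Y ∣prC
∣∪C∣prC≤ ⟨ p , q ⟩ ⟨ p′ , q′ ⟩ = ∣p∪q∣≤∣p∣+∣q∣ p p′

conjUnionSub : ∀ {n α} → Subset n → (Fin n → Conj α) → Conj α
conjUnionSub []            Y = ⊤C
conjUnionSub (inside ∷ p)  Y = Y zero ∪C conjUnionSub p (λ i → Y (suc i))
conjUnionSub (outside ∷ p) Y = conjUnionSub p (λ i → Y (suc i))

conjUnionC : ∀ {α β} → Conj α → (Flag → Fin (size α) → Conj β) → Conj β
conjUnionC C Y = conjUnionSub (sel pr C) (Y pr) ∪C conjUnionSub (sel np C) (Y np)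

∣conjUnionSub∣prC≤ : ∀ {n α} (p : Subset n) (Y : Fin n → Conj α) → ∣ conjUnionSub p Y ∣prC ≤ sumSub p (λ i → ∣ Y i ∣prC)
∣conjUnionSub∣prC≤ {α = α} []  Y = ≤-reflexive (∣⊤C∣prC {α})
∣conjUnionSub∣prC≤ (inside ∷ p)  Y = ≤-trans (∣∪C∣prC≤ (Y zero) (conjUnionSub p (λ i → Y (suc i)))) (+-monoʳ-≤ ∣ Y zero ∣prC (∣conjUnionSub∣prC≤ p _))
∣conjUnionSub∣prC≤ (outside ∷ p) Y = ∣conjUnionSub∣prC≤ p _

∣conjUnionC∣prC≤ : ∀ {α β} (C : Conj α) (Y : Flag → Fin (size α) → Conj β) →
  ∣ conjUnionC C Y ∣prC ≤ sumC C (λ f i → ∣ Y f i ∣prC)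
∣conjUnionC∣prC≤ C Y =
  ≤-trans (∣∪C∣prC≤ (conjUnionSub (sel pr C) (Y pr)) (conjUnionSub (sel np C) (Y np)))
          (+-mono-≤ (∣conjUnionSub∣prC≤ (sel pr C) _) (∣conjUnionSub∣prC≤ (sel np C) _))

duplConj : ∀ {α β} → Conj β → Conj α → (Flag → Fin (size α) → Conj β) → ℕ
duplConj X₀ C Xs = (∣ X₀ ∣prC + sumC C (λ f i → ∣ Xs f i ∣prC)) ∸ ∣ X₀ ∪C conjUnionC C Xs ∣prC

duplConj-⊤C : ∀ {α β} (C : Conj α) → duplConj (⊤C {β}) C (λ _ _ → ⊤C) ≡ 0
duplConj-⊤C {β = β} C = trans (cong (_∸ ∣ ⊤C ∪C conjUnionC C (λ _ _ → ⊤C {β}) ∣prC)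
    (cong₂ _+_ (∣⊤C∣prC {β}) (sumC-zero C (λ _ _ _ → ∣⊤C∣prC {β}))))
  (0∸n≡0 ∣ ⊤C ∪C conjUnionC C (λ _ _ → ⊤C {β}) ∣prC)

keep : ∀ {α} → Bool → Conj α → Conj α
keep b X = if b then X else ⊤C

∪E-identityˡ : ∀ {Δ} (Γ : Env Δ) → ∅E ∪E Γ ≡ Γ
∪E-identityˡ []      = refl
∪E-identityˡ (C ∷ Γ) = cong₂ _∷_ (∪C-identityˡ C) (∪E-identityˡ Γ)

∪E-identityʳ : ∀ {Δ} (Γ : Env Δ) → Γ ∪E ∅E ≡ Γ
∪E-identityʳ []      = refl
∪E-identityʳ (C ∷ Γ) = cong₂ _∷_ (∪C-identityʳ C) (∪E-identityʳ Γ)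

∅E↾pr : ∀ {Δ} → ∅E {Δ} ↾pr ≡ ∅E
∅E↾pr {[]}    = refl
∅E↾pr {α ∷ Δ} = cong (⊤C ∷_) ∅E↾pr

∣∅E∣E : ∀ {Δ} → ∣ ∅E {Δ} ∣E ≡ 0
∣∅E∣E {[]}    = refl
∣∅E∣E {α ∷ Δ} = cong₂ (λ a b → a + a + b) (∣⊥∣≡0 (size α)) (∣∅E∣E {Δ})

restrictBy-∅E : ∀ P {Δ} → restrictBy P (∅E {Δ}) ≡ ∅E
restrictBy-∅E P {[]}    = refl
restrictBy-∅E P {α ∷ Δ} with P (ord α)
... | true  = cong (⊤C ∷_) (restrictBy-∅E P)
... | false = cong (⊤C ∷_) (restrictBy-∅E P)

↾pr-∪E : ∀ {Δ} (Γ Γ′ : Env Δ) → (Γ ∪E Γ′) ↾pr ≡ (Γ ↾pr) ∪E (Γ′ ↾pr)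
↾pr-∪E []              []                = refl
↾pr-∪E (⟨ p , q ⟩ ∷ Γ) (⟨ p′ , q′ ⟩ ∷ Γ′) =
  cong₂ _∷_ (cong ⟨ p ∪ p′ ,_⟩ (sym (∪-identityʳ ∅ₛ))) (↾pr-∪E Γ Γ′)

∣∪E∣≤ : ∀ {Δ} (Γ Γ′ : Env Δ) → ∣ Γ ∪E Γ′ ∣E ≤ ∣ Γ ∣E + ∣ Γ′ ∣E
∣∪E∣≤ []              []                = z≤n
∣∪E∣≤ (⟨ p , q ⟩ ∷ Γ) (⟨ p′ , q′ ⟩ ∷ Γ′) = begin
  ∣ p ∪ p′ ∣ + ∣ q ∪ q′ ∣ + ∣ Γ ∪E Γ′ ∣E
    ≤⟨ +-mono-≤ (+-mono-≤ (∣p∪q∣≤∣p∣+∣q∣ p p′) (∣p∪q∣≤∣p∣+∣q∣ q q′)) (∣∪E∣≤ Γ Γ′) ⟩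
  (∣ p ∣ + ∣ p′ ∣) + (∣ q ∣ + ∣ q′ ∣) + (∣ Γ ∣E + ∣ Γ′ ∣E)
    ≡⟨ cong (_+ (∣ Γ ∣E + ∣ Γ′ ∣E)) (interchange (∣ p ∣) (∣ p′ ∣) (∣ q ∣) (∣ q′ ∣)) ⟩
  (∣ p ∣ + ∣ q ∣) + (∣ p′ ∣ + ∣ q′ ∣) + (∣ Γ ∣E + ∣ Γ′ ∣E)
    ≡⟨ interchange (∣ p ∣ + ∣ q ∣) (∣ p′ ∣ + ∣ q′ ∣) (∣ Γ ∣E) (∣ Γ′ ∣E) ⟩
  (∣ p ∣ + ∣ q ∣ + ∣ Γ ∣E) + (∣ p′ ∣ + ∣ q′ ∣ + ∣ Γ′ ∣E) ∎
  where open ≤-Reasoning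

∣_∣pr : ∀ {Δ} → Env Δ → ℕ
∣ Γ ∣pr = ∣ Γ ↾pr ∣E

∣∅E∣pr : ∀ {Δ} → ∣ ∅E {Δ} ∣pr ≡ 0
∣∅E∣pr {Δ} = trans (cong ∣_∣E (∅E↾pr {Δ})) (∣∅E∣E {Δ})

∣∪E∣pr≤ : ∀ {Δ} (Γ Γ′ : Env Δ) → ∣ Γ ∪E Γ′ ∣pr ≤ ∣ Γ ∣pr + ∣ Γ′ ∣pr
∣∪E∣pr≤ Γ Γ′ = subst (_≤ ∣ Γ ∣pr + ∣ Γ′ ∣pr) (cong ∣_∣E (sym (↾pr-∪E Γ Γ′))) (∣∪E∣≤ (Γ ↾pr) (Γ′ ↾pr))

∣unionSub∣pr≤ : ∀ {n Δ} (p : Subset n) (G : Fin n → Env Δ) → ∣ unionSub p G ∣pr ≤ sumSub p (λ i → ∣ G i ∣pr)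
∣unionSub∣pr≤ {Δ = Δ} []  G = ≤-reflexive (∣∅E∣pr {Δ})
∣unionSub∣pr≤ (inside ∷ p)  G = ≤-trans (∣∪E∣pr≤ (G zero) _) (+-monoʳ-≤ ∣ G zero ∣pr (∣unionSub∣pr≤ p _))
∣unionSub∣pr≤ (outside ∷ p) G = ∣unionSub∣pr≤ p _

∣unionC∣pr≤ : ∀ {α Δ} (C : Conj α) (G : Flag → Fin (size α) → Env Δ) → ∣ unionC C G ∣pr ≤ sumC C (λ f i → ∣ G f i ∣pr)
∣unionC∣pr≤ C G = ≤-trans (∣∪E∣pr≤ (unionSub (sel pr C) (G pr)) _) (+-mono-≤ (∣unionSub∣pr≤ (sel pr C) _) (∣unionSub∣pr≤ (sel np C) _))

unionSub-cong : ∀ {n Δ} (p : Subset n) {G H : Fin n → Env Δ} → (∀ i → i ∈ p → G i ≡ H i) → unionSub p G ≡ unionSub p H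
unionSub-cong []            eq = refl
unionSub-cong (inside ∷ p)  eq = cong₂ _∪E_ (eq zero here) (unionSub-cong p (λ i i∈p → eq (suc i) (there i∈p)))
unionSub-cong (outside ∷ p) eq = unionSub-cong p (λ i i∈p → eq (suc i) (there i∈p))

unionC-cong : ∀ {α Δ} (C : Conj α) {G H : Flag → Fin (size α) → Env Δ} →
  (∀ f i → i ∈ sel f C → G f i ≡ H f i) → unionC C G ≡ unionC C H
unionC-cong C eq = cong₂ _∪E_ (unionSub-cong (sel pr C) (eq pr)) (unionSub-cong (sel np C) (eq np))

unionSub-∅E : ∀ {n Δ} (p : Subset n) → unionSub {Δ = Δ} p (λ _ → ∅E) ≡ ∅E
unionSub-∅E []            = refl
unionSub-∅E (inside ∷ p)  = trans (∪E-identityˡ _) (unionSub-∅E p)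
unionSub-∅E (outside ∷ p) = unionSub-∅E p

unionC-∅E : ∀ {α Δ} (C : Conj α) → unionC {Δ = Δ} C (λ _ _ → ∅E) ≡ ∅E
unionC-∅E C = trans (cong₂ _∪E_ (unionSub-∅E (sel pr C)) (unionSub-∅E (sel np C))) (∪E-identityˡ ∅E)

duplC-∅E : ∀ P {Δ α} (Γ : Env Δ) (C : Conj α) → duplC (restrictBy P) Γ C (λ _ _ → ∅E) ≡ 0
duplC-∅E P {Δ} Γ C = begin
  (∣ R Γ ∣pr + sumC C (λ _ _ → ∣ R (∅E {Δ}) ∣pr)) ∸ ∣ R Γ ∪E unionC C (λ _ _ → R (∅E {Δ})) ∣pr
    ≡⟨ cong₂ _∸_ (cong (∣ R Γ ∣pr +_) (sumC-zero C (λ _ _ _ → ∣R∅E∣pr))) (cong ∣_∣pr R∅E-vanishes) ⟩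
  (∣ R Γ ∣pr + 0) ∸ ∣ R Γ ∣pr
    ≡⟨ cong (_∸ ∣ R Γ ∣pr) (+-identityʳ _) ⟩
  ∣ R Γ ∣pr ∸ ∣ R Γ ∣pr
    ≡⟨ n∸n≡0 ∣ R Γ ∣pr ⟩
  0 ∎
  where
  open ≡-Reasoning
  R = restrictBy P
  ∣R∅E∣pr : ∣ R (∅E {Δ}) ∣pr ≡ 0
  ∣R∅E∣pr = trans (cong ∣_∣pr (restrictBy-∅E P {Δ})) (∣∅E∣pr {Δ})
  R∅E-vanishes : R Γ ∪E unionC C (λ _ _ → R (∅E {Δ})) ≡ R Γ
  R∅E-vanishes = trans (cong (R Γ ∪E_) (trans (unionC-cong C (λ _ _ _ → restrictBy-∅E P)) (unionC-∅E C))) (∪E-identityʳ _)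

duplC-cong : ∀ {Δ α} (R : Env Δ → Env Δ) (Γ₀ : Env Δ) (C : Conj α) {Γs Γs′ : Flag → Fin (size α) → Env Δ} →
  (∀ f i → i ∈ sel f C → Γs f i ≡ Γs′ f i) → duplC R Γ₀ C Γs ≡ duplC R Γ₀ C Γs′
duplC-cong R Γ₀ C eq = cong₂ _∸_
  (cong (∣ R Γ₀ ∣pr +_) (sumC-cong C (λ f i i∈C → cong (λ Γ → ∣ R Γ ∣pr) (eq f i i∈C))))
  (cong (λ Γ → ∣ R Γ₀ ∪E Γ ∣pr) (unionC-cong C (λ f i i∈C → cong R (eq f i i∈C))))

Productive : ∀ {Δ} → ℕ → ℕ → Env Δ → Set
Productive u w Γ = (0 < u + w) ⊎ (Γ ↾pr ≢ ∅E)

Der-cast : ∀ {ℓ S Δ α} {n : Node (St S) Δ α} {Γ Γ′ : Env Δ} {u u′ w w′} {τ τ′ : Ty α} →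
  Γ ≡ Γ′ → u ≡ u′ → w ≡ w′ → τ ≡ τ′ → DerN ℓ S Γ n u w τ → DerN ℓ S Γ′ n u′ w′ τ′
Der-cast refl refl refl refl D = D

module Insertion {σ : Sort} where

  insert : ∀ Ξ {Δ} → Conj σ → Env (Ξ ++ Δ) → Env (Ξ ++ σ ∷ Δ)
  insert []      X Γ       = X ∷ Γ
  insert (β ∷ Ξ) X (C ∷ Γ) = C ∷ insert Ξ X Γ

  insert-∪E : ∀ Ξ {Δ} X Y (Γ Γ′ : Env (Ξ ++ Δ)) → insert Ξ X Γ ∪E insert Ξ Y Γ′ ≡ insert Ξ (X ∪C Y) (Γ ∪E Γ′)
  insert-∪E []      X Y Γ       Γ′        = refl
  insert-∪E (β ∷ Ξ) X Y (C ∷ Γ) (C′ ∷ Γ′) = cong (C ∪C C′ ∷_) (insert-∪E Ξ X Y Γ Γ′)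

  insert-∅E : ∀ Ξ {Δ} → insert Ξ {Δ} ⊤C ∅E ≡ ∅E
  insert-∅E []      = refl
  insert-∅E (β ∷ Ξ) = cong (⊤C ∷_) (insert-∅E Ξ)

  insert≡∅E⁻ : ∀ Ξ {Δ} X (Γ : Env (Ξ ++ Δ)) → insert Ξ X Γ ≡ ∅E → X ≡ ⊤C × Γ ≡ ∅E
  insert≡∅E⁻ []      X Γ       refl = refl , refl
  insert≡∅E⁻ (β ∷ Ξ) X (C ∷ Γ) eq =
    let X≡⊤C , Γ≡∅E = insert≡∅E⁻ Ξ X Γ (cong All.tail eq) in X≡⊤C , cong₂ _∷_ (cong All.head eq) Γ≡∅E

  insert-unionSub : ∀ Ξ {Δ n} (p : Subset n) (Y : Fin n → Conj σ) (G : Fin n → Env (Ξ ++ Δ)) →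
    unionSub p (λ i → insert Ξ (Y i) (G i)) ≡ insert Ξ (conjUnionSub p Y) (unionSub p G)
  insert-unionSub Ξ []            Y G = sym (insert-∅E Ξ)
  insert-unionSub Ξ (inside ∷ p)  Y G = trans (cong (insert Ξ (Y zero) (G zero) ∪E_) (insert-unionSub Ξ p _ _)) (insert-∪E Ξ _ _ _ _)
  insert-unionSub Ξ (outside ∷ p) Y G = insert-unionSub Ξ p _ _

  insert-unionC : ∀ Ξ {Δ α} (C : Conj α) (Y : Flag → Fin (size α) → Conj σ) (G : Flag → Fin (size α) → Env (Ξ ++ Δ)) →
    unionC C (λ f i → insert Ξ (Y f i) (G f i)) ≡ insert Ξ (conjUnionC C Y) (unionC C G)
  insert-unionC Ξ C Y G =
    trans (cong₂ _∪E_ (insert-unionSub Ξ (sel pr C) _ _) (insert-unionSub Ξ (sel np C) _ _)) (insert-∪E Ξ _ _ _ _)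

  prPart : Conj σ → Conj σ
  prPart ⟨ p , q ⟩ = ⟨ p , ∅ₛ ⟩

  insert-↾pr : ∀ Ξ {Δ} X (Γ : Env (Ξ ++ Δ)) → insert Ξ X Γ ↾pr ≡ insert Ξ (prPart X) (Γ ↾pr)
  insert-↾pr []      ⟨ p , q ⟩ Γ               = refl
  insert-↾pr (β ∷ Ξ) X         (⟨ p , q ⟩ ∷ Γ) = cong (⟨ p , ∅ₛ ⟩ ∷_) (insert-↾pr Ξ X Γ)

  ∣insert∣E : ∀ Ξ {Δ} X (Γ : Env (Ξ ++ Δ)) → ∣ insert Ξ X Γ ∣E ≡ ∣ Conj.prs X ∣ + ∣ Conj.nps X ∣ + ∣ Γ ∣E
  ∣insert∣E []      ⟨ p , q ⟩ Γ               = refl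
  ∣insert∣E (β ∷ Ξ) X         (⟨ p , q ⟩ ∷ Γ) =
    trans (cong (∣ p ∣ + ∣ q ∣ +_) (∣insert∣E Ξ X Γ)) (x∙yz≈y∙xz (∣ p ∣ + ∣ q ∣) (∣ Conj.prs X ∣ + ∣ Conj.nps X ∣) ∣ Γ ∣E)

  ∣insert∣pr : ∀ Ξ {Δ} X (Γ : Env (Ξ ++ Δ)) → ∣ insert Ξ X Γ ∣pr ≡ ∣ X ∣prC + ∣ Γ ∣pr
  ∣insert∣pr Ξ ⟨ p , q ⟩ Γ = begin
    ∣ insert Ξ ⟨ p , q ⟩ Γ ↾pr ∣E         ≡⟨ cong ∣_∣E (insert-↾pr Ξ ⟨ p , q ⟩ Γ) ⟩
    ∣ insert Ξ ⟨ p , ∅ₛ ⟩ (Γ ↾pr) ∣E      ≡⟨ ∣insert∣E Ξ ⟨ p , ∅ₛ ⟩ (Γ ↾pr) ⟩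
    ∣ p ∣ + ∣ ∅ₛ {size σ} ∣ + ∣ Γ ∣pr     ≡⟨ cong (λ k → ∣ p ∣ + k + ∣ Γ ∣pr) (∣⊥∣≡0 (size σ)) ⟩
    ∣ p ∣ + 0 + ∣ Γ ∣pr                   ≡⟨ cong (_+ ∣ Γ ∣pr) (+-identityʳ ∣ p ∣) ⟩
    ∣ p ∣ + ∣ Γ ∣pr                       ∎
    where open ≡-Reasoning

  restrictBy-insert : ∀ P Ξ {Δ} X (Γ : Env (Ξ ++ Δ)) →
    restrictBy P (insert Ξ X Γ) ≡ insert Ξ (keep (P (ord σ)) X) (restrictBy P Γ)
  restrictBy-insert P []      X Γ       = refl
  restrictBy-insert P (β ∷ Ξ) X (C ∷ Γ) = cong (keep (P (ord β)) C ∷_) (restrictBy-insert P Ξ X Γ)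

  duplC-insert : ∀ P Ξ {Δ α} (X₀ : Conj σ) (Γ₀ : Env (Ξ ++ Δ)) (C : Conj α)
    (Xs : Flag → Fin (size α) → Conj σ) (Γs : Flag → Fin (size α) → Env (Ξ ++ Δ)) →
    duplC (restrictBy P) (insert Ξ X₀ Γ₀) C (λ f i → insert Ξ (Xs f i) (Γs f i))
      ≡ duplConj (keep (P (ord σ)) X₀) C (λ f i → keep (P (ord σ)) (Xs f i)) + duplC (restrictBy P) Γ₀ C Γs
  duplC-insert P Ξ X₀ Γ₀ C Xs Γs = begin
    (∣ R (insert Ξ X₀ Γ₀) ∣pr + sumC C (λ f i → ∣ R (insert Ξ (Xs f i) (Γs f i)) ∣pr))
      ∸ ∣ R (insert Ξ X₀ Γ₀) ∪E unionC C (λ f i → R (insert Ξ (Xs f i) (Γs f i))) ∣pr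
      ≡⟨ cong₂ _∸_ (cong₂ _+_ (∣R-insert∣pr X₀ Γ₀) sum≡) union≡ ⟩
    ((a₀ + A₀) + (a₁ + A₁)) ∸ (b + B)
      ≡⟨ cong (_∸ (b + B)) (interchange a₀ A₀ a₁ A₁) ⟩
    ((a₀ + a₁) + (A₀ + A₁)) ∸ (b + B)
      ≡⟨ [m+n]∸[o+p]≡[m∸o]+[n∸p] b≤ B≤ ⟩
    ((a₀ + a₁) ∸ b) + ((A₀ + A₁) ∸ B) ∎
    where
    open ≡-Reasoning
    R : ∀ {Θ} → Env Θ → Env Θ
    R = restrictBy P
    K : Conj σ → Conj σ
    K = keep (P (ord σ))
    a₀ = ∣ K X₀ ∣prC
    A₀ = ∣ R Γ₀ ∣pr
    a₁ = sumC C (λ f i → ∣ K (Xs f i) ∣prC)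
    A₁ = sumC C (λ f i → ∣ R (Γs f i) ∣pr)
    b = ∣ K X₀ ∪C conjUnionC C (λ f i → K (Xs f i)) ∣prC
    B = ∣ R Γ₀ ∪E unionC C (λ f i → R (Γs f i)) ∣pr
    ∣R-insert∣pr : ∀ X Γ → ∣ R (insert Ξ X Γ) ∣pr ≡ ∣ K X ∣prC + ∣ R Γ ∣pr
    ∣R-insert∣pr X Γ = trans (cong ∣_∣pr (restrictBy-insert P Ξ X Γ)) (∣insert∣pr Ξ (K X) (R Γ))
    sum≡ : sumC C (λ f i → ∣ R (insert Ξ (Xs f i) (Γs f i)) ∣pr) ≡ a₁ + A₁
    sum≡ = trans (sumC-cong C (λ f i _ → ∣R-insert∣pr (Xs f i) (Γs f i))) (sumC-distrib-+ C (λ f i → ∣ K (Xs f i) ∣prC) (λ f i → ∣ R (Γs f i) ∣pr))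
    union≡ : ∣ R (insert Ξ X₀ Γ₀) ∪E unionC C (λ f i → R (insert Ξ (Xs f i) (Γs f i))) ∣pr ≡ b + B
    union≡ = trans (cong ∣_∣pr (begin
        R (insert Ξ X₀ Γ₀) ∪E unionC C (λ f i → R (insert Ξ (Xs f i) (Γs f i)))
          ≡⟨ cong₂ _∪E_ (restrictBy-insert P Ξ X₀ Γ₀) (unionC-cong C (λ f i _ → restrictBy-insert P Ξ (Xs f i) (Γs f i))) ⟩
        insert Ξ (K X₀) (R Γ₀) ∪E unionC C (λ f i → insert Ξ (K (Xs f i)) (R (Γs f i)))
          ≡⟨ cong (insert Ξ (K X₀) (R Γ₀) ∪E_) (insert-unionC Ξ C (λ f i → K (Xs f i)) (λ f i → R (Γs f i))) ⟩
        insert Ξ (K X₀) (R Γ₀) ∪E insert Ξ (conjUnionC C (λ f i → K (Xs f i))) (unionC C (λ f i → R (Γs f i)))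
          ≡⟨ insert-∪E Ξ _ _ _ _ ⟩
        insert Ξ (K X₀ ∪C conjUnionC C (λ f i → K (Xs f i))) (R Γ₀ ∪E unionC C (λ f i → R (Γs f i))) ∎))
      (∣insert∣pr Ξ _ _)
    b≤ : b ≤ a₀ + a₁
    b≤ = ≤-trans (∣∪C∣prC≤ (K X₀) (conjUnionC C (λ f i → K (Xs f i)))) (+-monoʳ-≤ a₀ (∣conjUnionC∣prC≤ C (λ f i → K (Xs f i))))
    B≤ : B ≤ A₀ + A₁
    B≤ = ≤-trans (∣∪E∣pr≤ (R Γ₀) _) (+-monoʳ-≤ A₀ (∣unionC∣pr≤ C (λ f i → R (Γs f i))))

  insert-↾pr≡∅E⁻ : ∀ Ξ {Δ} X (Γ : Env (Ξ ++ Δ)) → insert Ξ X Γ ↾pr ≡ ∅E → Conj.prs X ≡ ∅ₛ × Γ ↾pr ≡ ∅E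
  insert-↾pr≡∅E⁻ Ξ ⟨ p , q ⟩ Γ eq =
    let p≡∅ , Γ≡∅E = insert≡∅E⁻ Ξ ⟨ p , ∅ₛ ⟩ (Γ ↾pr) (trans (sym (insert-↾pr Ξ ⟨ p , q ⟩ Γ)) eq)
    in cong Conj.prs p≡∅ , Γ≡∅E

  insert-↾pr≡∅E⁺ : ∀ Ξ {Δ} X (Γ : Env (Ξ ++ Δ)) → Conj.prs X ≡ ∅ₛ → Γ ↾pr ≡ ∅E → insert Ξ X Γ ↾pr ≡ ∅E
  insert-↾pr≡∅E⁺ Ξ ⟨ p , q ⟩ Γ refl Γ≡∅E = trans (insert-↾pr Ξ ⟨ ∅ₛ , q ⟩ Γ) (trans (cong (insert Ξ ⊤C) Γ≡∅E) (insert-∅E Ξ))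

weakenE : ∀ {Ξ} Θ → Env Ξ → Env (Ξ ++ Θ)
weakenE Θ []      = ∅E
weakenE Θ (C ∷ E) = C ∷ weakenE Θ E

weakenE-∅E : ∀ {Ξ} Θ → weakenE Θ (∅E {Ξ}) ≡ ∅E
weakenE-∅E {[]}    Θ = refl
weakenE-∅E {β ∷ Ξ} Θ = cong (⊤C ∷_) (weakenE-∅E Θ)

weakenE-∪E : ∀ {Ξ} Θ (E E′ : Env Ξ) → weakenE Θ E ∪E weakenE Θ E′ ≡ weakenE Θ (E ∪E E′)
weakenE-∪E Θ []      []        = ∪E-identityˡ ∅E
weakenE-∪E Θ (C ∷ E) (C′ ∷ E′) = cong (C ∪C C′ ∷_) (weakenE-∪E Θ E E′)

weakenE-unionSub : ∀ {n Ξ} Θ (p : Subset n) (Es : Fin n → Env Ξ) →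
  unionSub p (λ i → weakenE Θ (Es i)) ≡ weakenE Θ (unionSub p Es)
weakenE-unionSub Θ []            Es = sym (weakenE-∅E Θ)
weakenE-unionSub Θ (inside ∷ p)  Es =
  trans (cong (weakenE Θ (Es zero) ∪E_) (weakenE-unionSub Θ p (λ i → Es (suc i)))) (weakenE-∪E Θ (Es zero) _)
weakenE-unionSub Θ (outside ∷ p) Es = weakenE-unionSub Θ p _

weakenE-unionC : ∀ {α Ξ} Θ (C : Conj α) (Es : Flag → Fin (size α) → Env Ξ) →
  unionC C (λ f i → weakenE Θ (Es f i)) ≡ weakenE Θ (unionC C Es)
weakenE-unionC Θ C Es =
  trans (cong₂ _∪E_ (weakenE-unionSub Θ (sel pr C) (Es pr)) (weakenE-unionSub Θ (sel np C) (Es np))) (weakenE-∪E Θ (unionSub (sel pr C) (Es pr)) _)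

∪E-unionC-weakenE : ∀ {α Ξ} Θ (C : Conj α) (E₀ : Env Ξ) (Es : Flag → Fin (size α) → Env Ξ) →
  weakenE Θ E₀ ∪E unionC C (λ f i → weakenE Θ (Es f i)) ≡ weakenE Θ (E₀ ∪E unionC C Es)
∪E-unionC-weakenE Θ C E₀ Es = trans (cong (weakenE Θ E₀ ∪E_) (weakenE-unionC Θ C Es)) (weakenE-∪E Θ E₀ (unionC C Es))

restrictBy-weakenE : ∀ P {Ξ} Θ (E : Env Ξ) → restrictBy P (weakenE Θ E) ≡ weakenE Θ (restrictBy P E)
restrictBy-weakenE P Θ []      = restrictBy-∅E P
restrictBy-weakenE P Θ (C ∷ E) = cong (_ ∷_) (restrictBy-weakenE P Θ E)

↾pr-weakenE : ∀ {Ξ} Θ (E : Env Ξ) → weakenE Θ E ↾pr ≡ weakenE Θ (E ↾pr)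
↾pr-weakenE Θ []              = ∅E↾pr
↾pr-weakenE Θ (⟨ p , q ⟩ ∷ E) = cong (_ ∷_) (↾pr-weakenE Θ E)

∣weakenE∣E : ∀ {Ξ} Θ (E : Env Ξ) → ∣ weakenE Θ E ∣E ≡ ∣ E ∣E
∣weakenE∣E Θ []              = ∣∅E∣E {Θ}
∣weakenE∣E Θ (⟨ p , q ⟩ ∷ E) = cong (_ +_) (∣weakenE∣E Θ E)

∣weakenE∣pr : ∀ {Ξ} Θ (E : Env Ξ) → ∣ weakenE Θ E ∣pr ≡ ∣ E ∣pr
∣weakenE∣pr Θ E = trans (cong ∣_∣E (↾pr-weakenE Θ E)) (∣weakenE∣E Θ (E ↾pr))

weakenE≡∅E⁻ : ∀ {Ξ} Θ (E : Env Ξ) → weakenE Θ E ≡ ∅E → E ≡ ∅E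
weakenE≡∅E⁻ Θ []      eq = refl
weakenE≡∅E⁻ Θ (C ∷ E) eq = cong₂ _∷_ (cong All.head eq) (weakenE≡∅E⁻ Θ E (cong All.tail eq))

productive-weakenE : ∀ {Ξ} Θ {u w} (E : Env Ξ) → Productive u w (weakenE Θ E) ⇔ Productive u w E
productive-weakenE Θ E = mk⇔
  (map₂ (λ ne eq → ne (trans (↾pr-weakenE Θ E) (trans (cong (weakenE Θ) eq) (weakenE-∅E Θ)))))
  (map₂ (λ ne eq → ne (weakenE≡∅E⁻ Θ (E ↾pr) (trans (sym (↾pr-weakenE Θ E)) eq))))

duplC-weakenE : ∀ P {α Ξ} Θ (E₀ : Env Ξ) (C : Conj α) (Es : Flag → Fin (size α) → Env Ξ) →
  duplC (restrictBy P) (weakenE Θ E₀) C (λ f i → weakenE Θ (Es f i)) ≡ duplC (restrictBy P) E₀ C Es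
duplC-weakenE P Θ E₀ C Es = cong₂ _∸_
  (cong₂ _+_ (∣R-weakenE∣pr E₀) (sumC-cong C (λ f i _ → ∣R-weakenE∣pr (Es f i))))
  (trans (cong ∣_∣pr (trans (cong₂ _∪E_ (restrictBy-weakenE P Θ E₀) R-union) (weakenE-∪E Θ (restrictBy P E₀) _)))
         (∣weakenE∣pr Θ (restrictBy P E₀ ∪E unionC C (λ f i → restrictBy P (Es f i)))))
  where
  ∣R-weakenE∣pr : ∀ E → ∣ restrictBy P (weakenE Θ E) ∣pr ≡ ∣ restrictBy P E ∣pr
  ∣R-weakenE∣pr E = trans (cong ∣_∣pr (restrictBy-weakenE P Θ E)) (∣weakenE∣pr Θ (restrictBy P E))
  R-union : unionC C (λ f i → restrictBy P (weakenE Θ (Es f i))) ≡ weakenE Θ (unionC C (λ f i → restrictBy P (Es f i)))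
  R-union = trans (unionC-cong C (λ f i _ → restrictBy-weakenE P Θ (Es f i))) (weakenE-unionC Θ C (λ f i → restrictBy P (Es f i)))

module WeakenedDerivations (ℓ : ℕ) (S : TermSystem) {σ : Sort} (L : St S [] σ) where

  private
    XS = XSys S L

  AllLow : Ctx → Set
  AllLow = All (λ α → ord α < ℓ)

  ↾≥-low : ∀ {Ξ} → AllLow Ξ → (E : Env Ξ) → E ↾≥ ℓ ≡ ∅E
  ↾≥-low []                      []      = refl
  ↾≥-low {β ∷ Ξ} (β<ℓ ∷ allLow) (C ∷ E) rewrite ≤ᵇ-false β<ℓ = cong (⊤C ∷_) (↾≥-low allLow E)

  ∣weakenE↾≥∣pr : ∀ {Ξ} Θ → AllLow Ξ → (E : Env Ξ) → ∣ weakenE Θ E ↾≥ ℓ ∣pr ≡ 0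
  ∣weakenE↾≥∣pr {Ξ} Θ allLow E = begin
    ∣ weakenE Θ E ↾≥ ℓ ∣pr      ≡⟨ cong ∣_∣pr (restrictBy-weakenE _ Θ E) ⟩
    ∣ weakenE Θ (E ↾≥ ℓ) ∣pr    ≡⟨ cong (λ E′ → ∣ weakenE Θ E′ ∣pr) (↾≥-low allLow E) ⟩
    ∣ weakenE Θ (∅E {Ξ}) ∣pr    ≡⟨ cong ∣_∣pr (weakenE-∅E {Ξ} Θ) ⟩
    ∣ ∅E {Ξ ++ Θ} ∣pr           ≡⟨ ∣∅E∣pr {Ξ ++ Θ} ⟩
    0                           ∎
    where open ≡-Reasoning

  single-wkVar : ∀ Ξ Θ {α} (x : Ξ ∋ α) f i → single (wkVar S L Ξ Θ x) f i ≡ weakenE Θ (single x f i)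
  single-wkVar (β ∷ Ξ) Θ here      f i = cong (only f i ∷_) (sym (weakenE-∅E Θ))
  single-wkVar (β ∷ Ξ) Θ (there x) f i = cong (⊤C ∷_) (single-wkVar Ξ Θ x f i)

  NoHighVarsNode : ∀ {Ξ α} → Node (St S) Ξ α → Set
  NoHighVarsNode (lam {α} s) = ord α < ℓ × NoHighVars ℓ S s
  NoHighVarsNode (app s₁ s₂) = NoHighVars ℓ S s₁ × NoHighVars ℓ S s₂
  NoHighVarsNode _           = ⊤

  noHighVars-step : ∀ {Ξ α} (t : St S Ξ α) → NoHighVars ℓ S t → NoHighVarsNode (step S t)
  noHighVars-step t noHigh with step S t in eq | noHigh t done
  ... | var x     | _   = tt
  ... | cA        | _   = tt
  ... | cB        | _   = tt
  ... | cC        | _   = tt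
  ... | cω        | _   = tt
  ... | lam s     | α<ℓ = α<ℓ , λ t′ r → noHigh t′ (viaLam eq r)
  ... | app s₁ s₂ | _   = (λ t′ r → noHigh t′ (viaFun eq r)) , (λ t′ r → noHigh t′ (viaArg eq r))

  record WeakenedDer (Ξ Θ Θ′ : Ctx) {α} (n : Node (St S) Ξ α) (Γ : Env (Ξ ++ Θ)) (u w : ℕ) (τ : Ty α) : Set where
    field
      env   : Env Ξ
      env≡  : Γ ≡ weakenE Θ env
      u≡0   : u ≡ 0
      der′  : DerN ℓ XS (weakenE Θ′ env) (nodeWk S L Ξ Θ′ n) u w τ
  open WeakenedDer

  constant : ∀ Ξ Θ Θ′ {α} {n : Node (St S) Ξ α} {w τ} →
    DerN ℓ XS ∅E (nodeWk S L Ξ Θ′ n) 0 w τ → WeakenedDer Ξ Θ Θ′ n ∅E 0 w τ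
  constant Ξ Θ Θ′ D = record
    { env = ∅E ; env≡ = sym (weakenE-∅E Θ) ; u≡0 = refl ; der′ = Der-cast (sym (weakenE-∅E Θ′)) refl refl refl D }

  -- A derivation for a weakening of a term whose bound variables are all of order < ℓ does
  -- not use the weakening part of the environment, has u = 0, and can be moved to any other weakening.
  weakenedDer : ∀ Ξ Θ Θ′ {α} (n : Node (St S) Ξ α) → NoHighVarsNode n → AllLow Ξ →
    ∀ {Γ u w τ} → DerN ℓ XS Γ (nodeWk S L Ξ Θ n) u w τ → WeakenedDer Ξ Θ Θ′ n Γ u w τ
  weakenedDer Ξ Θ Θ′ (var x) _ _ (ruleVar _ f i) = record
    { env  = single x f i
    ; env≡ = single-wkVar Ξ Θ x f i
    ; u≡0  = refl
    ; der′ = Der-cast (single-wkVar Ξ Θ′ x f i) refl refl refl (ruleVar (wkVar S L Ξ Θ′ x) f i)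
    }
  weakenedDer Ξ Θ Θ′ cA _ _ (ruleA f)  = constant Ξ Θ Θ′ (ruleA f)
  weakenedDer Ξ Θ Θ′ cB _ _ (ruleB₁ f) = constant Ξ Θ Θ′ (ruleB₁ f)
  weakenedDer Ξ Θ Θ′ cB _ _ (ruleB₂ f) = constant Ξ Θ Θ′ (ruleB₂ f)
  weakenedDer Ξ Θ Θ′ cC _ _ ruleC      = constant Ξ Θ Θ′ ruleC
  weakenedDer Ξ Θ Θ′ (lam {α} s) (α<ℓ , noHigh) allLow (ruleLam D)
    with weakenedDer (α ∷ Ξ) Θ Θ′ (step S s) (noHighVars-step s noHigh) (α<ℓ ∷ allLow) D
  ... | record { env = C ∷ E ; env≡ = refl ; u≡0 = u≡0 ; der′ = D′ } =
    record { env = E ; env≡ = refl ; u≡0 = u≡0 ; der′ = ruleLam D′ }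
  weakenedDer Ξ Θ Θ′ (app s₁ s₂) (noHigh₁ , noHigh₂) allLow
    (ruleApp {Γ₀ = Γ₀} {u₀ = u₀} {w₀ = w₀} {C = C} Γs us ws D₀ Ds flags) = record
    { env  = env W₀ ∪E unionC C Es
    ; env≡ = trans (cong₂ _∪E_ (env≡ W₀) (unionC-cong C Γs≡)) (∪E-unionC-weakenE Θ C (env W₀) Es)
    ; u≡0  = cong₂ _+_ dupl≥≡0 (cong₂ _+_ (u≡0 W₀) (sumC-zero C (λ f i i∈C → u≡0 (Ws f i i∈C))))
    ; der′ = Der-cast (∪E-unionC-weakenE Θ′ C (env W₀) Es) (cong (_+ (u₀ + sumC C us)) (dupl≡ _))
                      (cong (_+ (w₀ + sumC C ws)) (dupl≡ _)) refl
               (ruleApp (λ f i → weakenE Θ′ (Es f i)) us ws (der′ W₀) Ds′ flags′)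
    }
    where
    W₀ = weakenedDer Ξ Θ Θ′ (step S s₁) (noHighVars-step s₁ noHigh₁) allLow D₀
    Ws : ∀ f i → i ∈ sel f C → WeakenedDer Ξ Θ Θ′ (step S s₂) (Γs f i) (us f i) (ws f i) (decode i)
    Ws f i i∈C = weakenedDer Ξ Θ Θ′ (step S s₂) (noHighVars-step s₂ noHigh₂) allLow (Ds f i i∈C)
    Es : Flag → Fin _ → Env Ξ
    Es = extendC C (λ f i i∈C → env (Ws f i i∈C)) ∅E
    Es≡ : ∀ f i → (i∈C : i ∈ sel f C) → Es f i ≡ env (Ws f i i∈C)
    Es≡ = extendC-∈ C (λ f i i∈C → env (Ws f i i∈C)) ∅E
    Γs≡ : ∀ f i → i ∈ sel f C → Γs f i ≡ weakenE Θ (Es f i)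
    Γs≡ f i i∈C = trans (env≡ (Ws f i i∈C)) (cong (weakenE Θ) (sym (Es≡ f i i∈C)))
    Ds′ : ∀ f i → i ∈ sel f C → DerN ℓ XS (weakenE Θ′ (Es f i)) (step XS (wk Ξ Θ′ s₂)) (us f i) (ws f i) (decode i)
    Ds′ f i i∈C = Der-cast (cong (weakenE Θ′) (sym (Es≡ f i i∈C))) refl refl refl (der′ (Ws f i i∈C))
    flags′ : ∀ f i → i ∈ sel f C → (f ≡ pr) ⇔ Productive (us f i) (ws f i) (weakenE Θ′ (Es f i))
    flags′ f i i∈C = ⇔-sym (productive-weakenE Θ′ {us f i} {ws f i} (Es f i))
      ⇔-∘ (productive-weakenE Θ {us f i} {ws f i} (Es f i) ⇔-∘ subst (λ Γ → (f ≡ pr) ⇔ Productive (us f i) (ws f i) Γ) (Γs≡ f i i∈C) (flags f i i∈C))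
    dupl≡ : ∀ P → duplC (restrictBy P) (weakenE Θ′ (env W₀)) C (λ f i → weakenE Θ′ (Es f i)) ≡ duplC (restrictBy P) Γ₀ C Γs
    dupl≡ P = begin
      duplC (restrictBy P) (weakenE Θ′ (env W₀)) C (λ f i → weakenE Θ′ (Es f i)) ≡⟨ duplC-weakenE P Θ′ (env W₀) C Es ⟩
      duplC (restrictBy P) (env W₀) C Es                                          ≡⟨ duplC-weakenE P Θ (env W₀) C Es ⟨
      duplC (restrictBy P) (weakenE Θ (env W₀)) C (λ f i → weakenE Θ (Es f i))   ≡⟨ cong (λ Γ → duplC (restrictBy P) Γ C (λ f i → weakenE Θ (Es f i))) (env≡ W₀) ⟨
      duplC (restrictBy P) Γ₀ C (λ f i → weakenE Θ (Es f i))                      ≡⟨ duplC-cong (restrictBy P) Γ₀ C Γs≡ ⟨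
      duplC (restrictBy P) Γ₀ C Γs                                                 ∎
      where open ≡-Reasoning
    ∣↾≥∣pr≡0 : ∀ {Γ} E → Γ ≡ weakenE Θ E → ∣ Γ ↾≥ ℓ ∣pr ≡ 0
    ∣↾≥∣pr≡0 E refl = ∣weakenE↾≥∣pr Θ allLow E
    dupl≥≡0 : duplC (λ Γ → Γ ↾≥ ℓ) Γ₀ C Γs ≡ 0
    dupl≥≡0 = trans (cong (_∸ ∣ (Γ₀ ↾≥ ℓ) ∪E unionC C (λ f i → Γs f i ↾≥ ℓ) ∣pr)
                      (cong₂ _+_ (∣↾≥∣pr≡0 (env W₀) (env≡ W₀)) (sumC-zero C (λ f i i∈C → ∣↾≥∣pr≡0 (Es f i) (Γs≡ f i i∈C)))))
                    (0∸n≡0 ∣ (Γ₀ ↾≥ ℓ) ∪E unionC C (λ f i → Γs f i ↾≥ ℓ) ∣pr)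

allSubsets-complete : ∀ n (p : Subset n) → p List.∈ allSubsets n
allSubsets-complete zero    []            = Any.here refl
allSubsets-complete (suc n) (inside ∷ p)  = ∈-++⁺ˡ (∈-map⁺ (inside ∷_) (allSubsets-complete n p))
allSubsets-complete (suc n) (outside ∷ p) =
  ∈-++⁺ʳ (map (inside ∷_) (allSubsets n)) (∈-map⁺ (outside ∷_) (allSubsets-complete n p))

allTy-complete : ∀ α (τ : Ty α) → τ List.∈ allTy α
allTy-complete o       r                   = Any.here refl
allTy-complete (α ⇒ β) (⟨ p , q ⟩ , τ) = ∈-cartesianProduct⁺
  (∈-cartesianProductWith⁺ ⟨_,_⟩ (allSubsets-complete _ p) (allSubsets-complete _ q)) (allTy-complete β τ)

decode-surjective : ∀ {α} (τ : Ty α) → Σ (Fin (size α)) (λ i → decode i ≡ τ)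
decode-surjective {α} τ = Any.index (allTy-complete α τ) , sym (lookup-index (allTy-complete α τ))

module Uses (ℓ : ℕ) (S : TermSystem) {σ : Sort} (L : St S [] σ) (Δ : Ctx) where

  private
    n = size σ

  DerL : Fin n → ℕ → Set
  DerL i w = Der ℓ (XSys S L) ∅E (wk [] Δ L) 0 w (decode i)

  -- The types at which copies of L are used, with flag pr (weight > 0) or np (weight 0);
  -- at a pr-type, weight i is the largest w among the derivations of L at that type.
  record Uses : Set where
    field
      prTys npTys : Subset n
      weight      : Fin n → ℕ
      weight-out  : ∀ i → i ∉ prTys → weight i ≡ 0
      weight-pos  : ∀ i → i ∈ prTys → 0 < weight i
      derPr       : ∀ i → i ∈ prTys → DerL i (weight i)
      derNp       : ∀ i → i ∈ npTys → DerL i 0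
  open Uses public

  binding : Uses → Conj σ
  binding s = ⟨ prTys s , npTys s ⟩

  totalWeight : Uses → ℕ
  totalWeight s = sumSub (prTys s) (weight s)

  totalWeight-∅ : ∀ s → prTys s ≡ ∅ₛ → totalWeight s ≡ 0
  totalWeight-∅ s P≡∅ = trans (cong (λ p → sumSub p (weight s)) P≡∅) (sumSub-∅ n (weight s))

  ∣_∣U : Uses → ℕ
  ∣ s ∣U = ∣ prTys s ∣

  noUses : Uses
  noUses = record
    { prTys = ∅ₛ ; npTys = ∅ₛ ; weight = λ _ → 0 ; weight-out = λ _ _ → refl
    ; weight-pos = λ _ i∈∅ → contradiction i∈∅ ∉⊥
    ; derPr = λ _ i∈∅ → contradiction i∈∅ ∉⊥
    ; derNp = λ _ i∈∅ → contradiction i∈∅ ∉⊥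
    }

  flagOf : ℕ → Flag
  flagOf zero    = np
  flagOf (suc _) = pr

  useAt : (i : Fin n) (w : ℕ) → DerL i w → Uses
  useAt i zero    D = record
    { prTys = ∅ₛ ; npTys = ⁅ i ⁆ ; weight = λ _ → 0 ; weight-out = λ _ _ → refl
    ; weight-pos = λ _ j∈∅ → contradiction j∈∅ ∉⊥
    ; derPr = λ _ j∈∅ → contradiction j∈∅ ∉⊥
    ; derNp = λ j j∈⁅i⁆ → subst (λ k → DerL k 0) (sym (x∈⁅y⁆⇒x≡y i j∈⁅i⁆)) D
    }
  useAt i (suc w) D = record
    { prTys = ⁅ i ⁆ ; npTys = ∅ₛ ; weight = indicator i (suc w)
    ; weight-out = λ j j∉⁅i⁆ → indicator-out i (suc w) j (λ { refl → j∉⁅i⁆ (x∈⁅x⁆ i) })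
    ; weight-pos = λ j j∈⁅i⁆ → subst (λ k → 0 < indicator i (suc w) k) (sym (x∈⁅y⁆⇒x≡y i j∈⁅i⁆)) (subst (0 <_) (sym (indicator-at i (suc w))) z<s)
    ; derPr = λ j j∈⁅i⁆ → subst (λ k → DerL k (indicator i (suc w) k)) (sym (x∈⁅y⁆⇒x≡y i j∈⁅i⁆)) (subst (DerL i) (sym (indicator-at i (suc w))) D)
    ; derNp = λ _ j∈∅ → contradiction j∈∅ ∉⊥
    }

  binding-useAt : ∀ i w D → binding (useAt i w D) ≡ only (flagOf w) i
  binding-useAt i zero    D = refl
  binding-useAt i (suc w) D = refl

  totalWeight-useAt : ∀ i w D → totalWeight (useAt i w D) ≡ w
  totalWeight-useAt i zero    D = sumSub-∅ n _
  totalWeight-useAt i (suc w) D = trans (sumSub-⁅⁆ i _) (indicator-at i (suc w))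

  ∣useAt∣U≤ : ∀ i w D → ∣ useAt i w D ∣U ≤ w
  ∣useAt∣U≤ i zero    D = ≤-reflexive (∣⊥∣≡0 n)
  ∣useAt∣U≤ i (suc w) D = ≤-trans (≤-reflexive (∣⁅x⁆∣≡1 i)) (s≤s z≤n)
  _⊕_ : Uses → Uses → Uses
  s ⊕ t = record
    { prTys      = prTys s ∪ prTys t
    ; npTys      = npTys s ∪ npTys t
    ; weight     = λ i → weight s i ⊔ weight t i
    ; weight-out = λ i i∉ → cong₂ _⊔_ (weight-out s i (λ i∈ → i∉ (x∈p∪q⁺ (inj₁ i∈))))
                                      (weight-out t i (λ i∈ → i∉ (x∈p∪q⁺ (inj₂ i∈))))
    ; weight-pos = ∈∪-⊔-elim (prTys s) (prTys t) (λ _ w → 0 < w) (weight-out s) (weight-out t) (weight-pos s) (weight-pos t)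
    ; derPr      = ∈∪-⊔-elim (prTys s) (prTys t) DerL (weight-out s) (weight-out t) (derPr s) (derPr t)
    ; derNp      = λ i i∈ → [ derNp s i , derNp t i ] (x∈p∪q⁻ (npTys s) (npTys t) i∈)
    }

  mergeSub : ∀ {k} → Subset k → (Fin k → Uses) → Uses
  mergeSub []            us = noUses
  mergeSub (inside ∷ p)  us = us zero ⊕ mergeSub p (λ i → us (suc i))
  mergeSub (outside ∷ p) us = mergeSub p (λ i → us (suc i))

  mergeC : ∀ {α} → Conj α → (Flag → Fin (size α) → Uses) → Uses
  mergeC C us = mergeSub (sel pr C) (us pr) ⊕ mergeSub (sel np C) (us np)

  binding-mergeSub : ∀ {k} (p : Subset k) (us : Fin k → Uses) → binding (mergeSub p us) ≡ conjUnionSub p (λ i → binding (us i))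
  binding-mergeSub []            us = refl
  binding-mergeSub (inside ∷ p)  us = cong (binding (us zero) ∪C_) (binding-mergeSub p _)
  binding-mergeSub (outside ∷ p) us = binding-mergeSub p _

  binding-mergeC : ∀ {α} (C : Conj α) (us : Flag → Fin (size α) → Uses) →
    binding (mergeC C us) ≡ conjUnionC C (λ f i → binding (us f i))
  binding-mergeC C us = cong₂ _∪C_ (binding-mergeSub (sel pr C) (us pr)) (binding-mergeSub (sel np C) (us np))

  -- Merging uses whose pr-types number c in total and whose weights add up to T: each of the
  -- excess pr-types lost in the merge (counted with multiplicity) at most doubles the weight.
  record MergeBound (c T : ℕ) (s : Uses) : Set where
    field
      excess  : ℕ
      count≡  : c ≡ ∣ s ∣U + excess
      weight≤ : T ≤ 2 ^ excess * totalWeight s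
  open MergeBound public

  mergeBound-single : ∀ s → MergeBound ∣ s ∣U (totalWeight s) s
  mergeBound-single s = record { excess = 0 ; count≡ = sym (+-identityʳ ∣ s ∣U) ; weight≤ = ≤-reflexive (sym (+-identityʳ _)) }

  mergeBound-none : MergeBound 0 0 noUses
  mergeBound-none = record { excess = 0 ; count≡ = sym (cong (_+ 0) (∣⊥∣≡0 n)) ; weight≤ = z≤n }

  mergeBound-⊕ : ∀ {c c′ T T′ s t} → MergeBound c T s → MergeBound c′ T′ t → MergeBound (c + c′) (T + T′) (s ⊕ t)
  mergeBound-⊕ {c} {c′} {T} {T′} {s} {t} b b′ = record
    { excess  = (e + e′) + k
    ; count≡  = begin
        c + c′                                         ≡⟨ cong₂ _+_ (count≡ b) (count≡ b′) ⟩
        (∣ s ∣U + e) + (∣ t ∣U + e′)                   ≡⟨ interchange ∣ s ∣U e ∣ t ∣U e′ ⟩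
        (∣ s ∣U + ∣ t ∣U) + (e + e′)                   ≡⟨ cong (_+ (e + e′)) (∣p∣+∣q∣≡∣p∪q∣+∣p∩q∣ (prTys s) (prTys t)) ⟩
        (∣ s ⊕ t ∣U + k) + (e + e′)                    ≡⟨ +-assoc ∣ s ⊕ t ∣U k (e + e′) ⟩
        ∣ s ⊕ t ∣U + (k + (e + e′))                    ≡⟨ cong (∣ s ⊕ t ∣U +_) (+-comm k (e + e′)) ⟩
        ∣ s ⊕ t ∣U + ((e + e′) + k)                    ∎
    ; weight≤ = ≤-2^-trans (e + e′) k (+-mono-≤-2^ e e′ (weight≤ b) (weight≤ b′))
                  (sumSub-∪-⊔ (prTys s) (prTys t) (weight s) (weight t))
    }
    where
    open ≡-Reasoning
    e = excess b
    e′ = excess b′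
    k = ∣ prTys s ∩ prTys t ∣

  mergeBound-mergeSub : ∀ {k} (p : Subset k) (us : Fin k → Uses) →
    MergeBound (sumSub p (λ i → ∣ us i ∣U)) (sumSub p (λ i → totalWeight (us i))) (mergeSub p us)
  mergeBound-mergeSub []            us = mergeBound-none
  mergeBound-mergeSub (inside ∷ p)  us = mergeBound-⊕ (mergeBound-single (us zero)) (mergeBound-mergeSub p _)
  mergeBound-mergeSub (outside ∷ p) us = mergeBound-mergeSub p _

  mergeBound-mergeC : ∀ {α} (C : Conj α) (us : Flag → Fin (size α) → Uses) →
    MergeBound (sumC C (λ f i → ∣ us f i ∣U)) (sumC C (λ f i → totalWeight (us f i))) (mergeC C us)
  mergeBound-mergeC C us = mergeBound-⊕ (mergeBound-mergeSub (sel pr C) (us pr)) (mergeBound-mergeSub (sel np C) (us np))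

module Abstraction (ℓ : ℕ) (S : TermSystem) {σ : Sort} (L : St S [] σ)
                   (ord-σ : ord σ ≡ ℓ) (noHighL : NoHighVars ℓ S L) (Δ : Ctx) where

  open Uses ℓ S L Δ
  open Insertion {σ}
  open WeakenedDerivations ℓ S L

  private
    XS = XSys S L

  record Counts : Set where
    field
      uses      : Uses
      uK wK N d : ℕ
  open Counts public

  -- For a derivation of K[L/x] with counters u ⊕ w and one of K with counters uK ⊕ wK,
  -- N is the part of w contributed by the copies of L, and d the duplication among the
  -- bindings of x, which only the derivation of K incurs.
  record Fits (c : Counts) (u w : ℕ) : Set where
    field
      uK≡        : uK c ≡ u + d c
      w≡         : w ≡ wK c + N c
      N≤         : N c ≤ 2 ^ d c * totalWeight (uses c)
      d+∣uses∣≤N : d c + ∣ uses c ∣U ≤ N c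
  open Fits public

  record IsAbstraction (c : Counts) (Ξ : Ctx) {α} (nd : Node (St S) (Ξ ++ σ ∷ Δ) α)
                       (Γ : Env (Ξ ++ Δ)) (u w : ℕ) (τ : Ty α) : Set where
    field
      derK : DerN ℓ XS (insert Ξ (binding (uses c)) Γ) (nodeOrig S L nd) (uK c) (wK c) τ
      fits : Fits c u w
  open IsAbstraction public

  Abstraction : ∀ Ξ {α} → Node (St S) (Ξ ++ σ ∷ Δ) α → Env (Ξ ++ Δ) → ℕ → ℕ → Ty α → Set
  Abstraction Ξ nd Γ u w τ = Σ Counts (λ c → IsAbstraction c Ξ nd Γ u w τ)

  silent⇒ : ∀ {c u w} → Fits c u w → u + w ≡ 0 → uK c + wK c ≡ 0 × prTys (uses c) ≡ ∅ₛ
  silent⇒ {c} {u} F u+w≡0 =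
    cong₂ _+_ (trans (uK≡ F) (cong₂ _+_ u≡0 (m+n≡0⇒m≡0 (d c) d+∣uses∣≡0))) (m+n≡0⇒m≡0 (wK c) wK+N≡0) ,
    ∣p∣≡0⇒p≡∅ (prTys (uses c)) (m+n≡0⇒n≡0 (d c) d+∣uses∣≡0)
    where
    u≡0 = m+n≡0⇒m≡0 u u+w≡0
    wK+N≡0 = trans (sym (w≡ F)) (m+n≡0⇒n≡0 u u+w≡0)
    d+∣uses∣≡0 = n≤0⇒n≡0 (≤-trans (d+∣uses∣≤N F) (≤-reflexive (m+n≡0⇒n≡0 (wK c) wK+N≡0)))

  silent⇐ : ∀ {c u w} → Fits c u w → uK c + wK c ≡ 0 → prTys (uses c) ≡ ∅ₛ → u + w ≡ 0
  silent⇐ {c} {u} F uK+wK≡0 P≡∅ = cong₂ _+_ u≡0 (trans (w≡ F) (cong₂ _+_ (m+n≡0⇒n≡0 (uK c) uK+wK≡0) N≡0))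
    where
    u+d≡0 = trans (sym (uK≡ F)) (m+n≡0⇒m≡0 (uK c) uK+wK≡0)
    u≡0 = m+n≡0⇒m≡0 u u+d≡0
    N≡0 = n≤0⇒n≡0 (≤-trans (N≤ F) (≤-reflexive (trans (cong (2 ^ d c *_) (totalWeight-∅ (uses c) P≡∅)) (*-zeroʳ (2 ^ d c)))))

  productive⇔ : ∀ {c Ξ α nd Γ u w τ} → IsAbstraction c Ξ {α} nd Γ u w τ →
    Productive u w Γ ⇔ Productive (uK c) (wK c) (insert Ξ (binding (uses c)) Γ)
  productive⇔ {c} {Ξ} {Γ = Γ} {u} {w} A = mk⇔ to from
    where
    X = binding (uses c)
    to : Productive u w Γ → Productive (uK c) (wK c) (insert Ξ X Γ)
    to (inj₂ Γ↾pr≢∅E) = inj₂ (λ eq → Γ↾pr≢∅E (proj₂ (insert-↾pr≡∅E⁻ Ξ X Γ eq)))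
    to (inj₁ 0<u+w) with uK c + wK c ≟ 0
    ... | no  uK+wK≢0 = inj₁ (n≢0⇒n>0 uK+wK≢0)
    ... | yes uK+wK≡0 = inj₂ (λ eq → <⇒≢ 0<u+w (sym (silent⇐ (fits A) uK+wK≡0 (proj₁ (insert-↾pr≡∅E⁻ Ξ X Γ eq)))))
    from : Productive (uK c) (wK c) (insert Ξ X Γ) → Productive u w Γ
    from p with u + w ≟ 0
    ... | no u+w≢0 = inj₁ (n≢0⇒n>0 u+w≢0)
    ... | yes u+w≡0 with silent⇒ (fits A) u+w≡0 | p
    ...   | uK+wK≡0 , _   | inj₁ 0<uK+wK = contradiction (sym uK+wK≡0) (<⇒≢ 0<uK+wK)
    ...   | _       , P≡∅ | inj₂ ne      = inj₂ (λ Γ↾pr≡∅E → ne (insert-↾pr≡∅E⁺ Ξ X Γ P≡∅ Γ↾pr≡∅E))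

  unchanged : ∀ {Ξ α} {nd : Node (St S) (Ξ ++ σ ∷ Δ) α} {Γ u w τ} →
    DerN ℓ XS (insert Ξ ⊤C Γ) (nodeOrig S L nd) u w τ → Abstraction Ξ nd Γ u w τ
  unchanged {u = u} {w} D =
    record { uses = noUses ; uK = u ; wK = w ; N = 0 ; d = 0 } ,
    record { derK = D
           ; fits = record { uK≡ = sym (+-identityʳ u) ; w≡ = sym (+-identityʳ w) ; N≤ = z≤n
                           ; d+∣uses∣≤N = ≤-reflexive (∣⊥∣≡0 (size σ)) } }

  SingleAt : ∀ Ξ {α} → (Ξ ++ σ ∷ Δ) ∋ α → (α ≡ σ) ⊎ ((Ξ ++ Δ) ∋ α) → Set
  SingleAt Ξ x (inj₁ refl) = ∀ f i → single x f i ≡ insert Ξ (only f i) ∅E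
  SingleAt Ξ x (inj₂ y)    = ∀ f i → single x f i ≡ insert Ξ ⊤C (single y f i)

  single-splitVar : ∀ Ξ {α} (x : (Ξ ++ σ ∷ Δ) ∋ α) → SingleAt Ξ x (splitVar S L Ξ x)
  single-splitVar []      here      f i = refl
  single-splitVar []      (there x) f i = refl
  single-splitVar (β ∷ Ξ) here      f i = cong (only f i ∷_) (sym (insert-∅E Ξ))
  single-splitVar (β ∷ Ξ) (there x) with splitVar S L Ξ x | single-splitVar Ξ x
  ... | inj₁ refl | single≡ = λ f i → cong (⊤C ∷_) (single≡ f i)
  ... | inj₂ y    | single≡ = λ f i → cong (⊤C ∷_) (single≡ f i)

  weakenE-[] : ∀ Θ (E : Env []) → weakenE Θ E ≡ ∅E
  weakenE-[] Θ [] = refl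

  -- An occurrence of x: the derivation of the copy of L it was replaced by becomes a single use.
  abstraction-x : ∀ Ξ (x : (Ξ ++ σ ∷ Δ) ∋ σ) → SingleAt Ξ x (inj₁ refl) → ∀ {Γ u w τ} →
    DerN ℓ XS Γ (nodeWk S L [] (Ξ ++ Δ) (step S L)) u w τ → Abstraction Ξ (var x) Γ u w τ
  abstraction-x Ξ x single≡ {Γ} {u} {w} {τ} D =
    record { uses = useAt i w DL ; uK = 0 ; wK = 0 ; N = w ; d = 0 } ,
    record { derK = Der-cast single≡Γ refl refl decode-i≡τ (ruleVar x (flagOf w) i)
           ; fits = record
             { uK≡ = sym (trans (+-identityʳ u) (u≡0 WL))
             ; w≡ = refl
             ; N≤ = ≤-reflexive (sym (trans (*-identityˡ _) (totalWeight-useAt i w DL)))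
             ; d+∣uses∣≤N = ∣useAt∣U≤ i w DL } }
    where
    open WeakenedDer
    WL = weakenedDer [] (Ξ ++ Δ) Δ (step S L) (noHighVars-step L noHighL) [] D
    i = proj₁ (decode-surjective τ)
    decode-i≡τ = proj₂ (decode-surjective τ)
    DL : DerL i w
    DL = Der-cast (weakenE-[] Δ (env WL)) (u≡0 WL) refl (sym decode-i≡τ) (der′ WL)
    single≡Γ : single x (flagOf w) i ≡ insert Ξ (binding (useAt i w DL)) Γ
    single≡Γ = begin
      single x (flagOf w) i                  ≡⟨ single≡ (flagOf w) i ⟩
      insert Ξ (only (flagOf w) i) ∅E        ≡⟨ cong₂ (insert Ξ) (sym (binding-useAt i w DL)) (sym (trans (env≡ WL) (weakenE-[] (Ξ ++ Δ) (env WL)))) ⟩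
      insert Ξ (binding (useAt i w DL)) Γ    ∎
      where open ≡-Reasoning

  module _ {γ} (c₀ : Counts) (C : Conj γ) (cs : Flag → Fin (size γ) → Counts) where

    mergedUses : Uses
    mergedUses = uses c₀ ⊕ mergeC C (λ f i → uses (cs f i))

    mergeBound-app : MergeBound (∣ uses c₀ ∣U + sumC C (λ f i → ∣ uses (cs f i) ∣U))
                                (totalWeight (uses c₀) + sumC C (λ f i → totalWeight (uses (cs f i)))) mergedUses
    mergeBound-app = mergeBound-⊕ (mergeBound-single (uses c₀)) (mergeBound-mergeC C (λ f i → uses (cs f i)))

    duplX : ℕ
    duplX = excess mergeBound-app

    duplConj-app : duplConj (binding (uses c₀)) C (λ f i → binding (uses (cs f i))) ≡ duplX
    duplConj-app = begin
      (∣ uses c₀ ∣U + sumC C (λ f i → ∣ uses (cs f i) ∣U)) ∸ ∣ binding (uses c₀) ∪C conjUnionC C (λ f i → binding (uses (cs f i))) ∣prC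
        ≡⟨ cong₂ _∸_ (count≡ mergeBound-app) (cong (λ X → ∣ binding (uses c₀) ∪C X ∣prC) (sym (binding-mergeC C (λ f i → uses (cs f i))))) ⟩
      (∣ mergedUses ∣U + duplX) ∸ ∣ mergedUses ∣U
        ≡⟨ m+n∸m≡n ∣ mergedUses ∣U duplX ⟩
      duplX ∎
      where open ≡-Reasoning

    appCounts : ℕ → ℕ → Counts
    appCounts dupl≥ dupl< = record
      { uses = mergedUses
      ; uK   = (duplX + dupl≥) + (uK c₀ + sumC C (λ f i → uK (cs f i)))
      ; wK   = dupl< + (wK c₀ + sumC C (λ f i → wK (cs f i)))
      ; N    = N c₀ + sumC C (λ f i → N (cs f i))
      ; d    = (d c₀ + sumC C (λ f i → d (cs f i))) + duplX
      }

    fits-app : ∀ {u₀ w₀} {us ws : Flag → Fin (size γ) → ℕ} dupl≥ dupl< →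
      Fits c₀ u₀ w₀ → (∀ f i → i ∈ sel f C → Fits (cs f i) (us f i) (ws f i)) →
      Fits (appCounts dupl≥ dupl<) (dupl≥ + (u₀ + sumC C us)) (dupl< + (w₀ + sumC C ws))
    fits-app {u₀} {w₀} {us} {ws} dupl≥ dupl< F₀ Fs = record
      { uK≡ = begin-equality
          (duplX + dupl≥) + (uK c₀ + ΣuK)               ≡⟨ cong ((duplX + dupl≥) +_) (cong₂ _+_ (uK≡ F₀) ΣuK≡) ⟩
          (duplX + dupl≥) + ((u₀ + d c₀) + (Σu + Σd))   ≡⟨ solve 6 (λ x D u₀ d₀ U Dd → (x :+ D) :+ ((u₀ :+ d₀) :+ (U :+ Dd))
                                                                             := (D :+ (u₀ :+ U)) :+ ((d₀ :+ Dd) :+ x)) refl duplX dupl≥ u₀ (d c₀) Σu Σd ⟩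
          (dupl≥ + (u₀ + Σu)) + ((d c₀ + Σd) + duplX)   ∎
      ; w≡ = begin-equality
          dupl< + (w₀ + Σw)                          ≡⟨ cong (dupl< +_) (cong₂ _+_ (w≡ F₀) Σw≡) ⟩
          dupl< + ((wK c₀ + N c₀) + (ΣwK + ΣN))      ≡⟨ solve 5 (λ D w₀ n₀ W N → D :+ ((w₀ :+ n₀) :+ (W :+ N))
                                                                            := (D :+ (w₀ :+ W)) :+ (n₀ :+ N)) refl dupl< (wK c₀) (N c₀) ΣwK ΣN ⟩
          (dupl< + (wK c₀ + ΣwK)) + (N c₀ + ΣN)      ∎
      ; N≤ = ≤-2^-trans (d c₀ + Σd) duplX
               (+-mono-≤-2^ (d c₀) Σd (N≤ F₀) (≤-trans (sumC-mono-≤ C (λ f i i∈C → N≤ (Fs f i i∈C)))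
                                                        (sumC-2^*≤ C (λ f i → d (cs f i)) (λ f i → totalWeight (uses (cs f i))))))
               (weight≤ mergeBound-app)
      ; d+∣uses∣≤N = begin
          ((d c₀ + Σd) + duplX) + ∣ mergedUses ∣U
            ≡⟨ solve 3 (λ D x m → (D :+ x) :+ m := (m :+ x) :+ D) refl (d c₀ + Σd) duplX ∣ mergedUses ∣U ⟩
          (∣ mergedUses ∣U + duplX) + (d c₀ + Σd)
            ≡⟨ cong (_+ (d c₀ + Σd)) (count≡ mergeBound-app) ⟨
          (∣ uses c₀ ∣U + Σ∣uses∣) + (d c₀ + Σd)
            ≡⟨ solve 4 (λ a A b B → (a :+ A) :+ (b :+ B) := (b :+ a) :+ (B :+ A)) refl ∣ uses c₀ ∣U Σ∣uses∣ (d c₀) Σd ⟩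
          (d c₀ + ∣ uses c₀ ∣U) + (Σd + Σ∣uses∣)
            ≡⟨ cong ((d c₀ + ∣ uses c₀ ∣U) +_) (sumC-distrib-+ C (λ f i → d (cs f i)) (λ f i → ∣ uses (cs f i) ∣U)) ⟨
          (d c₀ + ∣ uses c₀ ∣U) + sumC C (λ f i → d (cs f i) + ∣ uses (cs f i) ∣U)
            ≤⟨ +-mono-≤ (d+∣uses∣≤N F₀) (sumC-mono-≤ C (λ f i i∈C → d+∣uses∣≤N (Fs f i i∈C))) ⟩
          N c₀ + ΣN
            ∎
      }
      where
      open ≤-Reasoning
      Σu = sumC C us
      Σw = sumC C ws
      ΣuK = sumC C (λ f i → uK (cs f i))
      ΣwK = sumC C (λ f i → wK (cs f i))
      ΣN = sumC C (λ f i → N (cs f i))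
      Σd = sumC C (λ f i → d (cs f i))
      Σ∣uses∣ = sumC C (λ f i → ∣ uses (cs f i) ∣U)
      ΣuK≡ : ΣuK ≡ Σu + Σd
      ΣuK≡ = trans (sumC-cong C (λ f i i∈C → uK≡ (Fs f i i∈C))) (sumC-distrib-+ C us (λ f i → d (cs f i)))
      Σw≡ : Σw ≡ ΣwK + ΣN
      Σw≡ = trans (sumC-cong C (λ f i i∈C → w≡ (Fs f i i∈C))) (sumC-distrib-+ C (λ f i → wK (cs f i)) (λ f i → N (cs f i)))

  noCounts : Counts
  noCounts = record { uses = noUses ; uK = 0 ; wK = 0 ; N = 0 ; d = 0 }

  duplC≥-insert : ∀ Ξ {α} (X₀ : Conj σ) (Γ₀ : Env (Ξ ++ Δ)) (C : Conj α) (Xs : Flag → Fin (size α) → Conj σ)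
    (Γs : Flag → Fin (size α) → Env (Ξ ++ Δ)) →
    duplC (λ Γ → Γ ↾≥ ℓ) (insert Ξ X₀ Γ₀) C (λ f i → insert Ξ (Xs f i) (Γs f i))
      ≡ duplConj X₀ C Xs + duplC (λ Γ → Γ ↾≥ ℓ) Γ₀ C Γs
  duplC≥-insert Ξ X₀ Γ₀ C Xs Γs = trans (duplC-insert (ℓ ≤ᵇ_) Ξ X₀ Γ₀ C Xs Γs)
    (cong (λ b → duplConj (keep b X₀) C (λ f i → keep b (Xs f i)) + duplC (λ Γ → Γ ↾≥ ℓ) Γ₀ C Γs) ℓ≤ᵇordσ)
    where
    ℓ≤ᵇordσ : (ℓ ≤ᵇ ord σ) ≡ true
    ℓ≤ᵇordσ = Equivalence.to T-≡ (≤⇒≤ᵇ (≤-reflexive (sym ord-σ)))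

  duplC<-insert : ∀ Ξ {α} (X₀ : Conj σ) (Γ₀ : Env (Ξ ++ Δ)) (C : Conj α) (Xs : Flag → Fin (size α) → Conj σ)
    (Γs : Flag → Fin (size α) → Env (Ξ ++ Δ)) →
    duplC (λ Γ → Γ ↾< ℓ) (insert Ξ X₀ Γ₀) C (λ f i → insert Ξ (Xs f i) (Γs f i)) ≡ duplC (λ Γ → Γ ↾< ℓ) Γ₀ C Γs
  duplC<-insert Ξ X₀ Γ₀ C Xs Γs = trans (duplC-insert (_<ᵇ ℓ) Ξ X₀ Γ₀ C Xs Γs)
    (trans (cong (λ b → duplConj (keep b X₀) C (λ f i → keep b (Xs f i)) + duplC (λ Γ → Γ ↾< ℓ) Γ₀ C Γs) (<ᵇ-false (≤-reflexive (sym ord-σ))))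
           (cong (_+ duplC (λ Γ → Γ ↾< ℓ) Γ₀ C Γs) (duplConj-⊤C {β = σ} C)))

  abstraction-app : ∀ Ξ {γ β} {s₁ : St S (Ξ ++ σ ∷ Δ) (γ ⇒ β)} {s₂ : St S (Ξ ++ σ ∷ Δ) γ}
    {Γ₀ u₀ w₀ C τ} (Γs : Flag → Fin (size γ) → Env (Ξ ++ Δ)) (us ws : Flag → Fin (size γ) → ℕ) →
    (∀ f i → i ∈ sel f C → (f ≡ pr) ⇔ Productive (us f i) (ws f i) (Γs f i)) →
    Abstraction Ξ (step S s₁) Γ₀ u₀ w₀ (C , τ) →
    (∀ f i → i ∈ sel f C → Abstraction Ξ (step S s₂) (Γs f i) (us f i) (ws f i) (decode i)) →
    Abstraction Ξ (app s₁ s₂) (Γ₀ ∪E unionC C Γs)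
      (duplC (λ Γ → Γ ↾≥ ℓ) Γ₀ C Γs + (u₀ + sumC C us)) (duplC (λ Γ → Γ ↾< ℓ) Γ₀ C Γs + (w₀ + sumC C ws)) τ
  abstraction-app Ξ {s₂ = s₂} {Γ₀} {C = C} Γs us ws flags (c₀ , A₀) As =
    appCounts c₀ C cs dupl≥ dupl< ,
    record
      { derK = Der-cast env≡ (cong (_+ (uK c₀ + sumC C (λ f i → uK (cs f i)))) dupl≥-insert)
                             (cong (_+ (wK c₀ + sumC C (λ f i → wK (cs f i)))) dupl<-insert) refl
                 (ruleApp (λ f i → insert Ξ (Xs f i) (Γs f i)) (λ f i → uK (cs f i)) (λ f i → wK (cs f i))
                   (derK A₀) (λ f i i∈C → derK (As′ f i i∈C)) (λ f i i∈C → productive⇔ (As′ f i i∈C) ⇔-∘ flags f i i∈C))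
      ; fits = fits-app c₀ C cs dupl≥ dupl< (fits A₀) (λ f i i∈C → fits (As′ f i i∈C))
      }
    where
    cs : Flag → Fin _ → Counts
    cs = extendC C (λ f i i∈C → proj₁ (As f i i∈C)) noCounts
    As′ : ∀ f i → i ∈ sel f C → IsAbstraction (cs f i) Ξ (step S s₂) (Γs f i) (us f i) (ws f i) (decode i)
    As′ f i i∈C = subst (λ c → IsAbstraction c Ξ (step S s₂) (Γs f i) (us f i) (ws f i) (decode i))
                        (sym (extendC-∈ C (λ f i i∈C → proj₁ (As f i i∈C)) noCounts f i i∈C)) (proj₂ (As f i i∈C))
    X₀ = binding (uses c₀)
    Xs : Flag → Fin _ → Conj σ
    Xs f i = binding (uses (cs f i))
    dupl≥ = duplC (λ Γ → Γ ↾≥ ℓ) Γ₀ C Γs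
    dupl< = duplC (λ Γ → Γ ↾< ℓ) Γ₀ C Γs
    env≡ : insert Ξ X₀ Γ₀ ∪E unionC C (λ f i → insert Ξ (Xs f i) (Γs f i)) ≡ insert Ξ (binding (mergedUses c₀ C cs)) (Γ₀ ∪E unionC C Γs)
    env≡ = begin
      insert Ξ X₀ Γ₀ ∪E unionC C (λ f i → insert Ξ (Xs f i) (Γs f i))   ≡⟨ cong (insert Ξ X₀ Γ₀ ∪E_) (insert-unionC Ξ C Xs Γs) ⟩
      insert Ξ X₀ Γ₀ ∪E insert Ξ (conjUnionC C Xs) (unionC C Γs)        ≡⟨ insert-∪E Ξ X₀ (conjUnionC C Xs) Γ₀ (unionC C Γs) ⟩
      insert Ξ (X₀ ∪C conjUnionC C Xs) (Γ₀ ∪E unionC C Γs)              ≡⟨ cong (λ X → insert Ξ (X₀ ∪C X) (Γ₀ ∪E unionC C Γs)) (binding-mergeC C (λ f i → uses (cs f i))) ⟨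
      insert Ξ (binding (mergedUses c₀ C cs)) (Γ₀ ∪E unionC C Γs)       ∎
      where open ≡-Reasoning
    dupl≥-insert : duplC (λ Γ → Γ ↾≥ ℓ) (insert Ξ X₀ Γ₀) C (λ f i → insert Ξ (Xs f i) (Γs f i)) ≡ duplX c₀ C cs + dupl≥
    dupl≥-insert = trans (duplC≥-insert Ξ X₀ Γ₀ C Xs Γs) (cong (_+ dupl≥) (duplConj-app c₀ C cs))
    dupl<-insert : duplC (λ Γ → Γ ↾< ℓ) (insert Ξ X₀ Γ₀) C (λ f i → insert Ξ (Xs f i) (Γs f i)) ≡ dupl<
    dupl<-insert = duplC<-insert Ξ X₀ Γ₀ C Xs Γs

  abstraction : ∀ Ξ {α} (nd : Node (St S) (Ξ ++ σ ∷ Δ) α) {Γ u w τ} →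
    DerN ℓ XS Γ (nodeSub S L Ξ Δ nd) u w τ → Abstraction Ξ nd Γ u w τ
  abstraction Ξ (var x) D with splitVar S L Ξ x | single-splitVar Ξ x
  abstraction Ξ (var x) D               | inj₁ refl | single≡ = abstraction-x Ξ x single≡ D
  abstraction Ξ (var x) (ruleVar _ f i) | inj₂ y    | single≡ = unchanged (Der-cast (single≡ f i) refl refl refl (ruleVar x f i))
  abstraction Ξ cA (ruleA f)  = unchanged (Der-cast (sym (insert-∅E Ξ)) refl refl refl (ruleA f))
  abstraction Ξ cB (ruleB₁ f) = unchanged (Der-cast (sym (insert-∅E Ξ)) refl refl refl (ruleB₁ f))
  abstraction Ξ cB (ruleB₂ f) = unchanged (Der-cast (sym (insert-∅E Ξ)) refl refl refl (ruleB₂ f))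
  abstraction Ξ cC ruleC      = unchanged (Der-cast (sym (insert-∅E Ξ)) refl refl refl ruleC)
  abstraction Ξ (lam {α} t) (ruleLam D) with abstraction (α ∷ Ξ) (step S t) D
  ... | c , A = c , record { derK = ruleLam (derK A) ; fits = fits A }
  abstraction Ξ (app s₁ s₂) (ruleApp Γs us ws D₀ Ds flags) =
    abstraction-app Ξ Γs us ws flags (abstraction Ξ (step S s₁) D₀) (λ f i i∈C → abstraction Ξ (step S s₂) (Ds f i i∈C))

  module _ {β} (K : St S (σ ∷ Δ) β) {Γ u w τ} (c : Counts) (A : IsAbstraction c [] (step S K) Γ u w τ) where

    redexDer : Der ℓ XS Γ (redexTm S L K) (u + d c) (wK c + totalWeight (uses c)) τ
    redexDer = Der-cast env≡ u≡ w≡′ refl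
      (ruleApp {s₁ = lamOf K} {s₂ = wk [] Δ L} (λ _ _ → ∅E) (λ _ _ → 0) ws (ruleLam (derK A)) derL flags)
      where
      open ≡-Reasoning
      X = binding (uses c)
      ws : Flag → Fin (size σ) → ℕ
      ws pr = weight (uses c)
      ws np = λ _ → 0
      derL : ∀ f i → i ∈ sel f X → DerL i (ws f i)
      derL pr = derPr (uses c)
      derL np = derNp (uses c)
      flags : ∀ f i → i ∈ sel f X → (f ≡ pr) ⇔ Productive 0 (ws f i) (∅E {Δ})
      flags pr i i∈P = mk⇔ (λ _ → inj₁ (weight-pos (uses c) i i∈P)) (λ _ → refl)
      flags np i _   = mk⇔ (λ ()) λ { (inj₁ ()) ; (inj₂ ∅E↾pr≢∅E) → contradiction ∅E↾pr ∅E↾pr≢∅E }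
      env≡ : Γ ∪E unionC X (λ _ _ → ∅E) ≡ Γ
      env≡ = trans (cong (Γ ∪E_) (unionC-∅E X)) (∪E-identityʳ Γ)
      u≡ : duplC (λ Γ → Γ ↾≥ ℓ) Γ X (λ _ _ → ∅E) + (uK c + sumC X (λ _ _ → 0)) ≡ u + d c
      u≡ = begin
        duplC (λ Γ → Γ ↾≥ ℓ) Γ X (λ _ _ → ∅E) + (uK c + sumC X (λ _ _ → 0))
          ≡⟨ cong₂ _+_ (duplC-∅E _ Γ X) (cong (uK c +_) (sumC-zero X (λ _ _ _ → refl))) ⟩
        uK c + 0
          ≡⟨ +-identityʳ (uK c) ⟩
        uK c
          ≡⟨ uK≡ (fits A) ⟩
        u + d c ∎
      w≡′ : duplC (λ Γ → Γ ↾< ℓ) Γ X (λ _ _ → ∅E) + (wK c + sumC X ws) ≡ wK c + totalWeight (uses c)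
      w≡′ = begin
        duplC (λ Γ → Γ ↾< ℓ) Γ X (λ _ _ → ∅E) + (wK c + sumC X ws)
          ≡⟨ cong₂ _+_ (duplC-∅E _ Γ X) (cong (λ k → wK c + (totalWeight (uses c) + k)) (sumSub-zero (npTys (uses c)) (λ _ _ → refl))) ⟩
        wK c + (totalWeight (uses c) + 0)
          ≡⟨ cong (wK c +_) (+-identityʳ (totalWeight (uses c))) ⟩
        wK c + totalWeight (uses c) ∎

    weight-bound : 2 ^ u * w ≤ 2 ^ (u + d c) * (wK c + totalWeight (uses c))
    weight-bound = subst (λ w → 2 ^ u * w ≤ 2 ^ (u + d c) * (wK c + totalWeight (uses c))) (sym (w≡ (fits A)))
      (≤-2^-trans u (d c) ≤-refl (+-mono-≤-2^ 0 (d c) (m≤m+n (wK c) 0) (N≤ (fits A))))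

    silent-redex : u + w ≡ 0 → (u + d c) + (wK c + totalWeight (uses c)) ≡ 0
    silent-redex u+w≡0 = begin
      (u + d c) + (wK c + totalWeight (uses c)) ≡⟨ cong₂ (λ a b → a + (wK c + b)) (sym (uK≡ (fits A))) (totalWeight-∅ (uses c) P≡∅) ⟩
      uK c + (wK c + 0)                        ≡⟨ cong (uK c +_) (+-identityʳ (wK c)) ⟩
      uK c + wK c                              ≡⟨ uK+wK≡0 ⟩
      0                                        ∎
      where
      open ≡-Reasoning
      uK+wK≡0 = proj₁ (silent⇒ (fits A) u+w≡0)
      P≡∅ = proj₂ (silent⇒ (fits A) u+w≡0)

lemma5 : (ℓ : ℕ) (S : TermSystem) {Δ : Ctx} {σ β : Sort}
    (K : St S (σ ∷ Δ) β) (L : St S [] σ) (Γ : Env Δ) (u w : ℕ) (τ : Ty β)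
    → ord σ ≡ ℓ
    → NoHighVars ℓ S L
    → Der ℓ (XSys S L) Γ (substTm S L K) u w τ
    → Σ ℕ (λ u' → Σ ℕ (λ w' →
        Der ℓ (XSys S L) Γ (redexTm S L K) u' w' τ
        × (2 ^ u * w ≤ 2 ^ u' * w')
        × (u + w ≡ 0 → u' + w' ≡ 0)))
lemma5 ℓ S {Δ} K L Γ u w τ ord-σ noHighL D =
  u + d c , wK c + totalWeight (uses c) , redexDer K c A , weight-bound K c A , silent-redex K c A
  where
  open Abstraction ℓ S L ord-σ noHighL Δ
  open Uses ℓ S L Δ using (totalWeight)
  c = proj₁ (abstraction [] (step S K) D)
  A = proj₂ (abstraction [] (step S K) D)
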